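{- Let $G\in\mathcal{F}$ have $n$ vertices. If $G$ is not isomorphic to any of the four graphs $\overline{F}_0,\overline{F}_1,\overline{F}_2,\overline{F}_3$ described below, then $\mathrm{mms}(G)\ge n/2-1$. Here: $\overline{F}_0=K_{3,3}$; $\overline{F}_1$ is obtained from two disjoint copies of $K_{2,3}$ by adding a perfect matching between the three degree-$2$ vertices of the first copy and the three degree-$2$ vertices of the second copy ($10$ vertices); $\overline{F}_2$ is obtained from a star $K_{1,3}$ with center $d$ and leaves $c_1,c_2,c_3$ and two disjoint copies of $K_{2,3}$ whose degree-$2$ vertices are $x_1,x_2,x_3$ and $y_1,y_2,y_3$ respectively, by adding the edges $c_ix_i$ and $c_iy_i$ for $i=1,2,3$ ($14$ vertices); $\overline{F}_3$ is obtained from three disjoint copies of $K_{2,3}$, whose degree-$2$ vertices are $a_1,a_2,a_3$, $b_1,b_2,b_3$ and $c_1,c_2,c_3$ respectively, and three new vertices $z_1,z_2,z_3$, by adding the edges $z_ia_i$, $z_ib_i$, $z_ic_i$ for $i=1,2,3$ ($18$ vertices).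
   Context: All graphs are finite and simple. A matching $M$ of $G$ is separating if $G-M$ has more connected components than $G$; $\mathrm{mms}(G)$ denotes the maximum size of a separating matching of $G$ ($0$ if none exists). Star product: given cubic graphs $G_1,G_2$ and vertices $u\in V(G_1)$, $v\in V(G_2)$, a star product $(G_1,u)*(G_2,v)$ is any graph obtained from the disjoint union of $G_1$ and $G_2$ by deleting $u$ and $v$ and joining the three neighbours of $u$ in $G_1$ to the three neighbours of $v$ in $G_2$ by a perfect matching (of size three, chosen arbitrarily). Let $H_0$ denote the Heawood graph. The class $\mathcal{F}$ consists of all graphs $G$ for which there is a sequence $G_0,G_1,\dots,G_m$ with $G_0\in\{H_0,K_{3,3}\}$, $G_m=G$, and, for each $i$, $G_{i+1}$ is a star product $(G_i,u)*(H,v)$ for some $H\in\{H_0,K_{3,3}\}$ and some vertices $u\in V(G_i)$, $v\in V(H)$. -}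

module Defs where

open import Data.Nat using (ℕ; zero; suc; _+_; _*_; _≤_; _<_; _≡ᵇ_)
open import Data.Fin using (Fin; toℕ)
open import Data.Bool using (Bool; true; false; not; _∧_; _∨_)
open import Data.Bool.Properties using (∨-comm)
open import Data.List using (List; []; _∷_; length; concatMap)
open import Data.Bool.ListAction using (any)
open import Data.List.Relation.Unary.All using (All)
open import Data.List.Relation.Unary.AllPairs using (AllPairs)
open import Data.Product using (Σ; _×_; _,_; proj₁; proj₂; ∃)
open import Data.Sum using (_⊎_)
open import Relation.Nullary using (¬_)
open import Relation.Binary.PropositionalEquality using (_≡_; _≢_; refl; cong₂)
open import Relation.Binary.Construct.Closure.ReflexiveTransitive using (Star)
open import Function.Bundles using (_↔_; Inverse)

record Graph (n : ℕ) : Set where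
  field
    adj    : Fin n → Fin n → Bool
    sym    : ∀ x y → adj x y ≡ adj y x
    irrefl : ∀ x → adj x x ≡ false
open Graph public

Iso : ∀ {n m} → Graph n → Graph m → Set
Iso {n} {m} G H =
  Σ (Fin n ↔ Fin m) λ e →
    ∀ x y → adj H (Inverse.to e x) (Inverse.to e y) ≡ adj G x y

private
  ≡ᵇ-sym : ∀ a b → (a ≡ᵇ b) ≡ (b ≡ᵇ a)
  ≡ᵇ-sym zero zero = refl
  ≡ᵇ-sym zero (suc b) = refl
  ≡ᵇ-sym (suc a) zero = refl
  ≡ᵇ-sym (suc a) (suc b) = ≡ᵇ-sym a b

  ≡ᵇ-refl : ∀ a → (a ≡ᵇ a) ≡ true
  ≡ᵇ-refl zero = refl
  ≡ᵇ-refl (suc a) = ≡ᵇ-refl a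

hasEdge : ∀ {n} → List (ℕ × ℕ) → Fin n → Fin n → Bool
hasEdge es x y = any (λ e → (toℕ x ≡ᵇ proj₁ e) ∧ (toℕ y ≡ᵇ proj₂ e)) es

fromEdges : ∀ n → List (ℕ × ℕ) → Graph n
fromEdges n es = record
  { adj    = λ x y → not (toℕ x ≡ᵇ toℕ y) ∧ (hasEdge es x y ∨ hasEdge es y x)
  ; sym    = λ x y → cong₂ (λ a b → not a ∧ b) (≡ᵇ-sym (toℕ x) (toℕ y))
                        (∨-comm (hasEdge es x y) (hasEdge es y x))
  ; irrefl = λ x → helper (toℕ x ≡ᵇ toℕ x) (≡ᵇ-refl (toℕ x))
  }
  where
  helper : ∀ b {c} → b ≡ true → not b ∧ c ≡ false
  helper .true refl = refl

K33 : Graph 6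
K33 = fromEdges 6
  ( (0 , 3) ∷ (0 , 4) ∷ (0 , 5) ∷ (1 , 3) ∷ (1 , 4) ∷ (1 , 5)
  ∷ (2 , 3) ∷ (2 , 4) ∷ (2 , 5) ∷ [])

-- Heawood graph: LCF notation [5,-5]^7 (14-cycle plus chords 2k -- 2k+5 mod 14).
Heawood : Graph 14
Heawood = fromEdges 14
  ( (0 , 1) ∷ (1 , 2) ∷ (2 , 3) ∷ (3 , 4) ∷ (4 , 5) ∷ (5 , 6) ∷ (6 , 7)
  ∷ (7 , 8) ∷ (8 , 9) ∷ (9 , 10) ∷ (10 , 11) ∷ (11 , 12) ∷ (12 , 13) ∷ (13 , 0)
  ∷ (0 , 5) ∷ (2 , 7) ∷ (4 , 9) ∷ (6 , 11) ∷ (8 , 13) ∷ (10 , 1) ∷ (12 , 3) ∷ [])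

K23 : ℕ → ℕ → ℕ → ℕ → ℕ → List (ℕ × ℕ)
K23 p q x1 x2 x3 =
  (p , x1) ∷ (p , x2) ∷ (p , x3) ∷ (q , x1) ∷ (q , x2) ∷ (q , x3) ∷ []

infixr 5 _++'_
_++'_ : List (ℕ × ℕ) → List (ℕ × ℕ) → List (ℕ × ℕ)
[] ++' ys = ys
(x ∷ xs) ++' ys = x ∷ (xs ++' ys)

Fbar0 : Graph 6
Fbar0 = K33

Fbar1 : Graph 10
Fbar1 = fromEdges 10
  (K23 0 1 2 3 4 ++' K23 5 6 7 8 9 ++' ((2 , 7) ∷ (3 , 8) ∷ (4 , 9) ∷ []))

-- F̄2: star d=0, c_i = 1,2,3; K_{2,3} (4,5 | x=6,7,8); K_{2,3} (9,10 | y=11,12,13);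
-- edges d c_i, c_i x_i, c_i y_i.
Fbar2 : Graph 14
Fbar2 = fromEdges 14
  (K23 4 5 6 7 8 ++' K23 9 10 11 12 13 ++'
   ( (0 , 1) ∷ (0 , 2) ∷ (0 , 3)
   ∷ (1 , 6) ∷ (2 , 7) ∷ (3 , 8)
   ∷ (1 , 11) ∷ (2 , 12) ∷ (3 , 13) ∷ []))

-- F̄3: K_{2,3} (0,1 | a=2,3,4), (5,6 | b=7,8,9), (10,11 | c=12,13,14);
-- z_i = 15,16,17 with edges z_i a_i, z_i b_i, z_i c_i.
Fbar3 : Graph 18
Fbar3 = fromEdges 18
  (K23 0 1 2 3 4 ++' K23 5 6 7 8 9 ++' K23 10 11 12 13 14 ++'
   ( (15 , 2) ∷ (15 , 7) ∷ (15 , 12)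
   ∷ (16 , 3) ∷ (16 , 8) ∷ (16 , 13)
   ∷ (17 , 4) ∷ (17 , 9) ∷ (17 , 14) ∷ []))

-- Star product, as a relation: G is (isomorphic to) a star product
-- (G1,u)*(G2,v).  f and g embed V(G1)-u and V(G2)-v into V(G) with
-- disjoint images covering V(G); adjacency inside each part is inherited;
-- the edges between the parts form a perfect matching between the
-- (images of the) neighbours of u and the neighbours of v.

record IsStarProduct {n₁ n₂ n : ℕ} (G₁ : Graph n₁) (u : Fin n₁)
                     (G₂ : Graph n₂) (v : Fin n₂) (G : Graph n) : Set where
  field
    f : Fin n₁ → Fin n
    g : Fin n₂ → Fin n
    f-inj : ∀ x x' → x ≢ u → x' ≢ u → f x ≡ f x' → x ≡ x'
    g-inj : ∀ y y' → y ≢ v → y' ≢ v → g y ≡ g y' → y ≡ y'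
    disjoint : ∀ x y → x ≢ u → y ≢ v → f x ≢ g y
    cover : ∀ w → (∃ λ x → x ≢ u × f x ≡ w) ⊎ (∃ λ y → y ≢ v × g y ≡ w)
    adj₁ : ∀ x x' → x ≢ u → x' ≢ u → adj G (f x) (f x') ≡ adj G₁ x x'
    adj₂ : ∀ y y' → y ≢ v → y' ≢ v → adj G (g y) (g y') ≡ adj G₂ y y'
    cross-sound : ∀ x y → x ≢ u → y ≢ v → adj G (f x) (g y) ≡ true →
                  adj G₁ u x ≡ true × adj G₂ v y ≡ true
    cross-left  : ∀ x → adj G₁ u x ≡ true →
                  Σ (Fin n₂) λ y → y ≢ v × adj G (f x) (g y) ≡ true ×
                    (∀ y' → y' ≢ v → adj G (f x) (g y') ≡ true → y' ≡ y)
    cross-right : ∀ y → adj G₂ v y ≡ true →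
                  Σ (Fin n₁) λ x → x ≢ u × adj G (f x) (g y) ≡ true ×
                    (∀ x' → x' ≢ u → adj G (f x') (g y) ≡ true → x' ≡ x)

data Block : ∀ {m} → Graph m → Set where
  heawood : Block Heawood
  k33     : Block K33

-- The class 𝓕 (closed under isomorphism, since star products are only
-- defined up to the arbitrary choice of labelling).
data InF : ∀ {n} → Graph n → Set₁ where
  base : ∀ {n m} {G : Graph n} {H : Graph m} → Block H → Iso G H → InF G
  step : ∀ {n₁ m n} {G₁ : Graph n₁} {H : Graph m} {G : Graph n} →
         InF G₁ → Block H → (u : Fin n₁) (v : Fin m) →
         IsStarProduct G₁ u H v G → InF G

record Matching {n : ℕ} (G : Graph n) : Set where
  field
    edges    : List (Fin n × Fin n)
    areEdges : All (λ e → adj G (proj₁ e) (proj₂ e) ≡ true) edges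
    disjointEnds : AllPairs _≢_ (concatMap (λ e → proj₁ e ∷ proj₂ e ∷ []) edges)
open Matching public

size : ∀ {n} {G : Graph n} → Matching G → ℕ
size M = length (edges M)

data InM {n : ℕ} : List (Fin n × Fin n) → Fin n → Fin n → Set where
  here-fwd : ∀ {x y es} → InM ((x , y) ∷ es) x y
  here-bwd : ∀ {x y es} → InM ((x , y) ∷ es) y x
  there    : ∀ {e es x y} → InM es x y → InM (e ∷ es) x y

AdjRel : ∀ {n} → Graph n → Fin n → Fin n → Set
AdjRel G x y = adj G x y ≡ true

AdjMinus : ∀ {n} (G : Graph n) → Matching G → Fin n → Fin n → Set
AdjMinus G M x y = adj G x y ≡ true × ¬ InM (edges M) x y

HasComponents : ∀ {n} → (Fin n → Fin n → Set) → ℕ → Set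
HasComponents {n} R k =
  Σ (Fin n → Fin k) λ c →
    (∀ i → ∃ λ x → c x ≡ i) ×
    (∀ x y → c x ≡ c y → Star R x y) ×
    (∀ x y → Star R x y → c x ≡ c y)

Separating : ∀ {n} (G : Graph n) → Matching G → Set
Separating G M =
  Σ ℕ λ k → Σ ℕ λ k' →
    HasComponents (AdjRel G) k × HasComponents (AdjMinus G M) k' × k < k'

-- mms(G) ≥ n/2 - 1  (mms is the maximum size of a separating matching,
-- 0 if none):  either n/2 - 1 ≤ 0, or some separating matching M has
-- |M| ≥ n/2 - 1, i.e. n ≤ 2|M| + 2.
MmsAtLeastHalfMinusOne : ∀ {n} → Graph n → Set
MmsAtLeastHalfMinusOne {n} G =
  n ≤ 2 ⊎ Σ (Matching G) λ M → Separating G M × n ≤ 2 * size M + 2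

-- A near-perfect matching cut of a graph G is a matching M exposing at most two vertices,
-- together with a 2-colouring of V(G) whose bichromatic edges all lie in M, at least one
-- existing.  G − M has no bichromatic edge, so it separates the ends of that edge and M is a
-- separating matching with 2|M| + 2 ≥ n.
--
-- By induction along the construction, every G ∈ 𝓕 has a near-perfect matching cut or is
-- isomorphic to one of F̄₀, …, F̄₃.  A cut of G₁ extends to every star product (G₁,u)*(G₂,v)
-- in which each edge of G₂ lies in a perfect matching (true of K₃,₃, of the Heawood graph and
-- of the F̄ᵢ): colour G₂ − v like u, let the neighbour y of v joined to the partner of u take
-- over u's place, and add a perfect matching of G₂ − v − y.  The Heawood graph has a cut, so
-- it remains to treat the star products of some F̄ᵢ with K₃,₃.  Whatever matching is used,
-- such a product is F̄ᵢ with one vertex replaced by a copy of K₂,₃, and a certified exhaustive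
-- check shows that each of these graphs has a cut or is isomorphic to F̄ᵢ₊₁ (the former always
-- for F̄₃).

module Submission where

open import Data.Bool using (Bool; true; false; not; _∧_; _∨_; _xor_; if_then_else_)
open import Data.Bool.Properties using (∨-comm; ∨-zeroʳ; ∧-zeroʳ; ¬-not) renaming (_≟_ to _≟ᵇ_)
open import Data.Empty using (⊥-elim)
open import Data.Fin using (Fin; zero; suc; toℕ; splitAt; join)
open import Data.Fin.Properties
  using (_≟_; all?; any?; injective⇒≤; toℕ-injective; suc-injective; splitAt-join; join-splitAt)
import Data.List as List
open import Data.List using (List; []; _∷_; length; map; filter; concatMap; allFin)
open import Data.List.Membership.Propositional using (_∈_)
open import Data.List.Membership.Propositional.Properties using (∈-filter⁺; ∈-allFin)
open import Data.List.Relation.Unary.All as All using (All; []; _∷_)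
open import Data.List.Relation.Unary.All.Properties using (all-filter) renaming (map⁺ to All-map⁺)
open import Data.List.Relation.Unary.AllPairs using (AllPairs; []; _∷_)
import Data.List.Relation.Unary.AllPairs.Properties as AllPairs
open import Data.List.Relation.Unary.Any using (here; there; index)
open import Data.List.Relation.Unary.Any.Properties using (lookup-index)
open import Data.List.Relation.Unary.Unique.Propositional.Properties using (allFin⁺)
open import Data.Nat using (ℕ; zero; suc; _+_; _*_; _≤_; _<_; _<?_; _≡ᵇ_; NonZero)
open import Data.Nat.DivMod using (_mod_)
open import Data.Nat.Properties using (<-cmp; <-asym; <-irrefl; +-comm; *-suc; ≤-trans; ≤-reflexive)
import Data.Product as Product
open import Data.Product using (Σ; ∃; ∃₂; _×_; _,_; proj₁; proj₂)
import Data.Sum as Sum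
open import Data.Sum using (_⊎_; inj₁; inj₂; [_,_])
open import Data.Vec using (Vec; lookup; []; _∷_)
open import Function using (_∘_; _on_)
open import Function.Bundles using (Inverse; mk↔ₛ′)
open import Function.Properties.Inverse using (↔-trans)
open import Level using (0ℓ)
open import Relation.Binary using (Rel; Decidable; Symmetric; IsDecEquivalence; tri<; tri≈; tri>)
import Relation.Binary.Construct.On as On
open import Relation.Binary.Construct.Closure.ReflexiveTransitive as Star using (Star; ε; _◅_; _◅◅_)
open import Relation.Binary.PropositionalEquality
  using (_≡_; _≢_; refl; sym; trans; cong; cong₂; subst; module ≡-Reasoning)
open import Relation.Nullary using (¬_; Dec; yes; no; does)
open import Relation.Nullary.Decidable
  using (True; toWitness; map′; from-yes; decidable-stable; dec-true; dec-false)
open import Relation.Nullary.Decidable using (_×-dec_; _⊎-dec_; _→-dec_; ¬?)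

open import Defs renaming (sym to adj-sym)



-- Matchings and near-perfect matching cuts

AdjRel-sym : ∀ {n} (G : Graph n) → Symmetric (AdjRel G)
AdjRel-sym G {x} {y} xy = trans (adj-sym G y x) xy

AdjRel⇒≢ : ∀ {n} (G : Graph n) {x y} → AdjRel G x y → x ≢ y
AdjRel⇒≢ G {x} xy refl with () ← trans (sym xy) (irrefl G x)

adjacent? : ∀ {n} (G : Graph n) → Decidable (AdjRel G)
adjacent? G x y = adj G x y ≟ᵇ true

record IsMatching {n} (G : Graph n) (mate : Fin n → Fin n) : Set where
  field
    involutive : ∀ x → mate (mate x) ≡ x
    adjacent   : ∀ x → mate x ≢ x → AdjRel G x (mate x)

  injective : ∀ {x y} → mate x ≡ mate y → x ≡ y
  injective {x} {y} p = trans (sym (involutive x)) (trans (cong mate p) (involutive y))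

isMatching? : ∀ {n} (G : Graph n) mate → Dec (IsMatching G mate)
isMatching? G mate =
  map′ (λ (i , a) → record { involutive = i ; adjacent = a })
       (λ m → IsMatching.involutive m , IsMatching.adjacent m)
    (all? (λ x → mate (mate x) ≟ x) ×-dec all? (λ x → ¬? (mate x ≟ x) →-dec adjacent? G x (mate x)))

record IsNearPerfectMatchingCut {n} (G : Graph n) (colour : Fin n → Fin 2) (mate : Fin n → Fin n)
                                (exposed₁ exposed₂ : Fin n) : Set where
  field
    isMatching          : IsMatching G mate
    fixed⇒exposed       : ∀ x → mate x ≡ x → x ≡ exposed₁ ⊎ x ≡ exposed₂
    bichromatic⇒matched : ∀ x y → AdjRel G x y → colour x ≢ colour y → mate x ≡ y
    bichromatic-edge    : ∃₂ λ x y → AdjRel G x y × colour x ≢ colour y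

  open IsMatching isMatching public

isNearPerfectMatchingCut? : ∀ {n} (G : Graph n) colour mate e₁ e₂ →
                            Dec (IsNearPerfectMatchingCut G colour mate e₁ e₂)
isNearPerfectMatchingCut? G colour mate e₁ e₂ =
  map′ (λ (m , f , b , e) → record
          { isMatching = m ; fixed⇒exposed = f ; bichromatic⇒matched = b ; bichromatic-edge = e })
       (λ c → let open IsNearPerfectMatchingCut c in
          isMatching , fixed⇒exposed , bichromatic⇒matched , bichromatic-edge)
    (isMatching? G mate
     ×-dec all? (λ x → mate x ≟ x →-dec (x ≟ e₁ ⊎-dec x ≟ e₂))
     ×-dec all? (λ x → all? λ y → adjacent? G x y →-dec (bichromatic? x y →-dec mate x ≟ y))
     ×-dec any? (λ x → any? λ y → adjacent? G x y ×-dec bichromatic? x y))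
  where
  bichromatic? : ∀ x y → Dec (colour x ≢ colour y)
  bichromatic? x y = ¬? (colour x ≟ colour y)

record NearPerfectMatchingCut {n} (G : Graph n) : Set where
  field
    colour                   : Fin n → Fin 2
    mate                     : Fin n → Fin n
    exposed₁ exposed₂        : Fin n
    isNearPerfectMatchingCut : IsNearPerfectMatchingCut G colour mate exposed₁ exposed₂

  open IsNearPerfectMatchingCut isNearPerfectMatchingCut public

-- Connected components

ClassLabelling : ∀ {n} → Rel (Fin n) 0ℓ → ℕ → Set
ClassLabelling {n} E k = Σ (Fin n → Fin k) λ c →
  (∀ i → ∃ λ x → c x ≡ i) ×
  (∀ x y → c x ≡ c y → E x y) ×
  (∀ x y → E x y → c x ≡ c y)

module _ {n} {E : Rel (Fin (suc n)) 0ℓ} (E-isDecEquivalence : IsDecEquivalence E) where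
  open IsDecEquivalence E-isDecEquivalence using ()
    renaming (refl to E-refl; sym to E-sym; trans to E-trans)

  ClassLabelling-join : ∀ {k} → ClassLabelling (E on suc) k →
                        ∀ x₀ → E zero (suc x₀) → ClassLabelling E k
  ClassLabelling-join {k} (c , surj , sound , complete) x₀ 0~x₀ = c′ , surj′ , sound′ , complete′
    where
    c′ : Fin (suc n) → Fin k
    c′ zero    = c x₀
    c′ (suc x) = c x
    surj′ : ∀ i → ∃ λ x → c′ x ≡ i
    surj′ i = suc (proj₁ (surj i)) , proj₂ (surj i)
    sound′ : ∀ x y → c′ x ≡ c′ y → E x y
    sound′ zero    zero    _ = E-refl
    sound′ zero    (suc y) p = E-trans 0~x₀ (sound x₀ y p)
    sound′ (suc x) zero    p = E-sym (E-trans 0~x₀ (sound x₀ x (sym p)))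
    sound′ (suc x) (suc y) p = sound x y p
    complete′ : ∀ x y → E x y → c′ x ≡ c′ y
    complete′ zero    zero    _ = refl
    complete′ zero    (suc y) e = complete x₀ y (E-trans (E-sym 0~x₀) e)
    complete′ (suc x) zero    e = complete x x₀ (E-trans e 0~x₀)
    complete′ (suc x) (suc y) e = complete x y e

  ClassLabelling-fresh : ∀ {k} → ClassLabelling (E on suc) k →
                       (∀ x → ¬ E zero (suc x)) → ClassLabelling E (suc k)
  ClassLabelling-fresh {k} (c , surj , sound , complete) alone = c′ , surj′ , sound′ , complete′
    where
    c′ : Fin (suc n) → Fin (suc k)
    c′ zero    = zero
    c′ (suc x) = suc (c x)
    surj′ : ∀ i → ∃ λ x → c′ x ≡ i
    surj′ zero    = zero , refl
    surj′ (suc i) = suc (proj₁ (surj i)) , cong suc (proj₂ (surj i))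
    sound′ : ∀ x y → c′ x ≡ c′ y → E x y
    sound′ zero    zero    _ = E-refl
    sound′ (suc x) (suc y) p = sound x y (suc-injective p)
    complete′ : ∀ x y → E x y → c′ x ≡ c′ y
    complete′ zero    zero    _ = refl
    complete′ zero    (suc y) e = ⊥-elim (alone y e)
    complete′ (suc x) zero    e = ⊥-elim (alone x (E-sym e))
    complete′ (suc x) (suc y) e = cong suc (complete x y e)

classLabelling : ∀ {n} {E : Rel (Fin n) 0ℓ} → IsDecEquivalence E → ∃ (ClassLabelling E)
classLabelling {zero} _ = 0 , (λ ()) , (λ ()) , (λ ()) , (λ ())
classLabelling {suc n} E-isDecEquivalence
  with classLabelling (On.isDecEquivalence suc E-isDecEquivalence)
     | any? (λ x → IsDecEquivalence._≟_ E-isDecEquivalence zero (suc x))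
... | k , c | yes (x₀ , 0~x₀) = k , ClassLabelling-join E-isDecEquivalence c x₀ 0~x₀
... | k , c | no ¬joins = suc k , ClassLabelling-fresh E-isDecEquivalence c (λ x e → ¬joins (x , e))

-- Reachability is decided by eliminating vertex zero: a walk of R between nonzero vertices is a
-- walk of Bypass₀ R, whose extra steps are the detours through zero.
Bypass₀ : ∀ {n} → Rel (Fin (suc n)) 0ℓ → Rel (Fin n) 0ℓ
Bypass₀ R x y = R (suc x) (suc y) ⊎ (R (suc x) zero × R zero (suc y))

module _ {n} {R : Rel (Fin (suc n)) 0ℓ} where

  Star-Bypass₀⇒Star : ∀ {x y} → Star (Bypass₀ R) x y → Star R (suc x) (suc y)
  Star-Bypass₀⇒Star ε                      = ε
  Star-Bypass₀⇒Star (inj₁ r ◅ w)           = r ◅ Star-Bypass₀⇒Star w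
  Star-Bypass₀⇒Star (inj₂ (r₁ , r₂) ◅ w)   = r₁ ◅ r₂ ◅ Star-Bypass₀⇒Star w

  mutual
    Star⇒Star-Bypass₀ : ∀ {x y} → Star R (suc x) (suc y) → Star (Bypass₀ R) x y
    Star⇒Star-Bypass₀ ε                     = ε
    Star⇒Star-Bypass₀ (_◅_ {j = suc z} r w) = inj₁ r ◅ Star⇒Star-Bypass₀ w
    Star⇒Star-Bypass₀ (_◅_ {j = zero} r w)  with z , r₂ , w′ ← leave-zero w =
      inj₂ (r , r₂) ◅ w′

    leave-zero : ∀ {y} → Star R zero (suc y) → ∃ λ z → R zero (suc z) × Star (Bypass₀ R) z y
    leave-zero (_◅_ {j = suc z} r w) = z , r , Star⇒Star-Bypass₀ w
    leave-zero (_◅_ {j = zero} _ w)  = leave-zero w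

reachable? : ∀ {n} {R : Rel (Fin n) 0ℓ} → Decidable R → Symmetric R → Decidable (Star R)
reachable? {zero}  R? R-sym ()
reachable? {suc n} {R} R? R-sym = decide
  where
  Bypass₀-sym : Symmetric (Bypass₀ R)
  Bypass₀-sym (inj₁ r)         = inj₁ (R-sym r)
  Bypass₀-sym (inj₂ (r₁ , r₂)) = inj₂ (R-sym r₂ , R-sym r₁)

  Bypass₀? : Decidable (Bypass₀ R)
  Bypass₀? x y = R? (suc x) (suc y) ⊎-dec (R? (suc x) zero ×-dec R? zero (suc y))

  bypass? : Decidable (Star (Bypass₀ R))
  bypass? = reachable? Bypass₀? Bypass₀-sym

  from-zero? : ∀ y → Dec (Star R zero (suc y))
  from-zero? y = map′ (λ (z , r , w) → r ◅ Star-Bypass₀⇒Star w) leave-zero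
                      (any? λ z → R? zero (suc z) ×-dec bypass? z y)

  decide : Decidable (Star R)
  decide zero    zero    = yes ε
  decide zero    (suc y) = from-zero? y
  decide (suc x) zero    = map′ (Star.reverse R-sym) (Star.reverse R-sym) (from-zero? x)
  decide (suc x) (suc y) = map′ Star-Bypass₀⇒Star Star⇒Star-Bypass₀ (bypass? x y)

components : ∀ {n} {R : Rel (Fin n) 0ℓ} → Decidable R → Symmetric R → ∃ (HasComponents R)
components R? R-sym = classLabelling record
  { isEquivalence = record { refl = ε ; sym = Star.reverse R-sym ; trans = _◅◅_ }
  ; _≟_           = reachable? R? R-sym
  }

injective-missing⇒< : ∀ {k k′} {s : Fin k → Fin k′} → (∀ {i j} → s i ≡ s j → i ≡ j) →
                      ∀ e → (∀ i → s i ≢ e) → k < k′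
injective-missing⇒< {k} {k′} {s} s-injective e missing = injective⇒≤ ι-injective
  where
  ι : Fin (suc k) → Fin k′
  ι zero    = e
  ι (suc i) = s i
  ι-injective : ∀ {i j} → ι i ≡ ι j → i ≡ j
  ι-injective {zero}  {zero}  _ = refl
  ι-injective {zero}  {suc j} p = ⊥-elim (missing j (sym p))
  ι-injective {suc i} {zero}  p = ⊥-elim (missing i p)
  ι-injective {suc i} {suc j} p = cong suc (s-injective p)

refinement-< : ∀ {n k k′} (c : Fin n → Fin k) (c′ : Fin n → Fin k′) →
               (∀ i → ∃ λ x → c x ≡ i) → (∀ x y → c′ x ≡ c′ y → c x ≡ c y) →
               ∀ {x₀ y₀} → c x₀ ≡ c y₀ → c′ x₀ ≢ c′ y₀ → k < k′
refinement-< {k = k} {k′} c c′ surj refines {x₀} {y₀} same split =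
  outside-image (c′ x₀ ≟ section (c x₀))
  where
  section : Fin k → Fin k′
  section i = c′ (proj₁ (surj i))

  section-injective : ∀ {i j} → section i ≡ section j → i ≡ j
  section-injective {i} {j} p = trans (sym (proj₂ (surj i))) (trans (refines _ _ p) (proj₂ (surj j)))

  missed : ∀ z → c z ≡ c x₀ → c′ z ≢ section (c x₀) → ∀ i → section i ≢ c′ z
  missed z z~x₀ fresh i p = fresh (subst (λ j → c′ z ≡ section j) i≡c-x₀ (sym p))
    where
    i≡c-x₀ : i ≡ c x₀
    i≡c-x₀ = trans (sym (proj₂ (surj i))) (trans (refines _ _ p) z~x₀)

  outside-image : Dec (c′ x₀ ≡ section (c x₀)) → k < k′
  outside-image (yes p) = injective-missing⇒< section-injective (c′ y₀)
                            (missed y₀ (sym same) λ q → split (trans p (sym q)))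
  outside-image (no ¬p) = injective-missing⇒< section-injective (c′ x₀) (missed x₀ refl ¬p)

-- Separating matchings from near-perfect matching cuts

complete⇒≤length : ∀ {n} (xs : List (Fin n)) → (∀ x → x ∈ xs) → n ≤ length xs
complete⇒≤length xs ∈xs = injective⇒≤ {f = index ∘ ∈xs} λ {x} {y} p →
  trans (lookup-index (∈xs x)) (trans (cong (List.lookup xs) p) (sym (lookup-index (∈xs y))))

InM-cons : ∀ {n} {p q x y : Fin n} {L} →
           (x ≡ p × y ≡ q) ⊎ (x ≡ q × y ≡ p) ⊎ InM L x y → InM ((p , q) ∷ L) x y
InM-cons (inj₁ (refl , refl))        = here-fwd
InM-cons (inj₂ (inj₁ (refl , refl))) = here-bwd
InM-cons (inj₂ (inj₂ r))             = there r

InM-uncons : ∀ {n} {p q x y : Fin n} {L} →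
             InM ((p , q) ∷ L) x y → (x ≡ p × y ≡ q) ⊎ (x ≡ q × y ≡ p) ⊎ InM L x y
InM-uncons here-fwd  = inj₁ (refl , refl)
InM-uncons here-bwd  = inj₂ (inj₁ (refl , refl))
InM-uncons (there r) = inj₂ (inj₂ r)

InM? : ∀ {n} (L : List (Fin n × Fin n)) → Decidable (InM L)
InM? []            x y = no λ ()
InM? ((p , q) ∷ L) x y = map′ InM-cons InM-uncons
  ((x ≟ p ×-dec y ≟ q) ⊎-dec (x ≟ q ×-dec y ≟ p) ⊎-dec InM? L x y)

InM-sym : ∀ {n} {L : List (Fin n × Fin n)} → Symmetric (InM L)
InM-sym here-fwd  = here-bwd
InM-sym here-bwd  = here-fwd
InM-sym (there r) = there (InM-sym r)

AllPairs-restrict : ∀ {A : Set} {P : A → Set} {R S : A → A → Set} →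
                    (∀ {x y} → P x → P y → R x y → S x y) →
                    ∀ {xs} → All P xs → AllPairs R xs → AllPairs S xs
AllPairs-restrict f []         []         = []
AllPairs-restrict f (px ∷ pxs) (rx ∷ rxs) =
  All.zipWith (λ (py , r) → f px py r) (pxs , rx) ∷ AllPairs-restrict f pxs rxs

module MatchingOfCut {n} {G : Graph n} (C : NearPerfectMatchingCut G) where
  open NearPerfectMatchingCut C

  -- Each matching edge is listed once, from its endpoint with the smaller index.
  Leader : Fin n → Set
  Leader x = toℕ x < toℕ (mate x)

  leaders : List (Fin n)
  leaders = filter (λ x → toℕ x <? toℕ (mate x)) (allFin n)

  edge : Fin n → Fin n × Fin n
  edge x = x , mate x

  endpoints : Fin n × Fin n → List (Fin n)
  endpoints e = proj₁ e ∷ proj₂ e ∷ []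

  Leader⇒matched : ∀ {x} → Leader x → mate x ≢ x
  Leader⇒matched lt p = <-irrefl (cong toℕ (sym p)) lt

  matched⇒Leader : ∀ x → mate x ≢ x → Leader x ⊎ Leader (mate x)
  matched⇒Leader x m≢x with <-cmp (toℕ x) (toℕ (mate x))
  ... | tri< lt _ _ = inj₁ lt
  ... | tri≈ _ eq _ = ⊥-elim (m≢x (sym (toℕ-injective eq)))
  ... | tri> _ _ gt = inj₂ (subst (λ z → toℕ (mate x) < toℕ z) (sym (involutive x)) gt)

  Apart : Fin n → Fin n → Set
  Apart x y = x ≢ y × x ≢ mate y × mate x ≢ y × mate x ≢ mate y

  Leader-≢mate : ∀ {x y} → Leader x → Leader y → x ≢ mate y
  Leader-≢mate {x} {y} lx ly x≡my =
    <-asym (subst (λ z → toℕ x < toℕ z) mx≡y lx) (subst (λ z → toℕ y < toℕ z) (sym x≡my) ly)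
    where
    mx≡y : mate x ≡ y
    mx≡y = trans (cong mate x≡my) (involutive y)

  Leaders-apart : ∀ {x y} → Leader x → Leader y → x ≢ y → Apart x y
  Leaders-apart lx ly x≢y =
    x≢y , Leader-≢mate lx ly , (λ p → Leader-≢mate ly lx (sym p)) , x≢y ∘ injective

  endpoints-All : ∀ {P : Fin n → Set} {xs} → All (λ x → P x × P (mate x)) xs →
                  All P (concatMap endpoints (map edge xs))
  endpoints-All []              = []
  endpoints-All ((p , q) ∷ pqs) = p ∷ q ∷ endpoints-All pqs

  endpoints-unique : ∀ {xs} → AllPairs Apart xs → All (λ x → x ≢ mate x) xs →
                     AllPairs _≢_ (concatMap endpoints (map edge xs))
  endpoints-unique []                 []              = []
  endpoints-unique (apart ∷ aparts) (x≢mx ∷ x≢mxs) =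
      (x≢mx ∷ endpoints-All (All.map (λ (p , q , _ , _) → p , q) apart))
    ∷ endpoints-All (All.map (λ (_ , _ , r , s) → r , s) apart)
    ∷ endpoints-unique aparts x≢mxs

  leaders-Leader : All Leader leaders
  leaders-Leader = all-filter _ (allFin n)

  matching : Matching G
  matching = record
    { edges        = map edge leaders
    ; areEdges     = All-map⁺ (All.map (λ lt → adjacent _ (Leader⇒matched lt)) leaders-Leader)
    ; disjointEnds = endpoints-unique
        (AllPairs-restrict Leaders-apart leaders-Leader (AllPairs.filter⁺ _ (allFin⁺ n)))
        (All.map (λ lt p → Leader⇒matched lt (sym p)) leaders-Leader)
    }

  ∈-leaders : ∀ {x} → Leader x → x ∈ leaders
  ∈-leaders lt = ∈-filter⁺ _ (∈-allFin _) lt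

  ∈-endpoints₁ : ∀ {x xs} → x ∈ xs → x ∈ concatMap endpoints (map edge xs)
  ∈-endpoints₁ (here refl) = here refl
  ∈-endpoints₁ (there x∈)  = there (there (∈-endpoints₁ x∈))

  ∈-endpoints₂ : ∀ {x xs} → x ∈ xs → mate x ∈ concatMap endpoints (map edge xs)
  ∈-endpoints₂ (here refl) = there (here refl)
  ∈-endpoints₂ (there x∈)  = there (there (∈-endpoints₂ x∈))

  covered : ∀ w → w ∈ exposed₁ ∷ exposed₂ ∷ concatMap endpoints (map edge leaders)
  covered w with mate w ≟ w
  ... | yes fixed with fixed⇒exposed w fixed
  ...   | inj₁ refl = here refl
  ...   | inj₂ refl = there (here refl)
  covered w | no m≢w with matched⇒Leader w m≢w
  ...   | inj₁ lw  = there (there (∈-endpoints₁ (∈-leaders lw)))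
  ...   | inj₂ lmw = there (there (subst (_∈ _) (involutive w) (∈-endpoints₂ (∈-leaders lmw))))

  length-endpoints : ∀ xs → length (concatMap endpoints (map edge xs)) ≡ 2 * length (map edge xs)
  length-endpoints []       = refl
  length-endpoints (x ∷ xs) = trans (cong (2 +_) (length-endpoints xs)) (sym (*-suc 2 (length (map edge xs))))

  size-bound : n ≤ 2 * size matching + 2
  size-bound = ≤-trans (complete⇒≤length _ covered)
                       (≤-reflexive (trans (cong (2 +_) (length-endpoints leaders)) (+-comm 2 _)))

  InM-edge : ∀ {x xs} → x ∈ xs → InM (map edge xs) x (mate x)
  InM-edge (here refl) = here-fwd
  InM-edge (there x∈)  = there (InM-edge x∈)

  matched⇒InM : ∀ x → mate x ≢ x → InM (edges matching) x (mate x)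
  matched⇒InM x m≢x with matched⇒Leader x m≢x
  ... | inj₁ lx  = InM-edge (∈-leaders lx)
  ... | inj₂ lmx = subst (λ z → InM _ z (mate x)) (involutive x) (InM-sym (InM-edge (∈-leaders lmx)))

  unmatched-monochromatic : ∀ {x y} → AdjMinus G matching x y → colour x ≡ colour y
  unmatched-monochromatic {x} {y} (xy , ¬xy∈M) = decidable-stable (colour x ≟ colour y) λ x≁y →
    let mx≡y = bichromatic⇒matched x y xy x≁y
    in ¬xy∈M (subst (InM _ x) mx≡y (matched⇒InM x λ mx≡x → AdjRel⇒≢ G xy (trans (sym mx≡x) mx≡y)))

  walk-monochromatic : ∀ {x y} → Star (AdjMinus G matching) x y → colour x ≡ colour y
  walk-monochromatic ε       = refl
  walk-monochromatic (r ◅ w) = trans (unmatched-monochromatic r) (walk-monochromatic w)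

  AdjMinus? : Decidable (AdjMinus G matching)
  AdjMinus? x y = adjacent? G x y ×-dec ¬? (InM? _ x y)

  AdjMinus-sym : Symmetric (AdjMinus G matching)
  AdjMinus-sym (xy , ¬xy∈M) = AdjRel-sym G xy , λ yx∈M → ¬xy∈M (InM-sym yx∈M)

  separating : Separating G matching
  separating
    with components (adjacent? G) (AdjRel-sym G) | components AdjMinus? AdjMinus-sym | bichromatic-edge
  ... | k , H@(c , surj , _ , complete) | k′ , H′@(c′ , _ , sound′ , _) | x₀ , y₀ , x₀y₀ , x₀≁y₀ =
    k , k′ , H , H′ , refinement-< c c′ surj refines (complete x₀ y₀ (x₀y₀ ◅ ε))
                                  (λ p → x₀≁y₀ (walk-monochromatic (sound′ x₀ y₀ p)))
    where
    refines : ∀ x y → c′ x ≡ c′ y → c x ≡ c y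
    refines x y p = complete x y (Star.map proj₁ (sound′ x y p))

nearPerfectMatchingCut⇒mms : ∀ {n} {G : Graph n} → NearPerfectMatchingCut G → MmsAtLeastHalfMinusOne G
nearPerfectMatchingCut⇒mms C = inj₂ (matching , separating , size-bound)
  where open MatchingOfCut C

-- Matching covered graphs and isomorphisms

record IsPerfectMatchingMinus {m} (H : Graph m) (v y : Fin m) (mate : Fin m → Fin m) : Set where
  field
    isMatching     : IsMatching H mate
    v-exposed      : mate v ≡ v
    y-exposed      : mate y ≡ y
    others-covered : ∀ x → x ≢ v → x ≢ y → mate x ≢ x

  open IsMatching isMatching public

isPerfectMatchingMinus? : ∀ {m} (H : Graph m) v y mate → Dec (IsPerfectMatchingMinus H v y mate)
isPerfectMatchingMinus? H v y mate =
  map′ (λ (m , ev , ey , c) → record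
          { isMatching = m ; v-exposed = ev ; y-exposed = ey ; others-covered = c })
       (λ p → let open IsPerfectMatchingMinus p in isMatching , v-exposed , y-exposed , others-covered)
    (isMatching? H mate ×-dec mate v ≟ v ×-dec mate y ≟ y
     ×-dec all? (λ x → ¬? (x ≟ v) →-dec (¬? (x ≟ y) →-dec ¬? (mate x ≟ x))))

-- Every edge vy lies in a perfect matching, namely vy together with matchingMinus v y.
-- Connectivity, part of the usual definition, is replaced by the absence of isolated vertices.
record IsMatchingCovered {m} (H : Graph m) (neighbour : Fin m → Fin m)
                         (matchingMinus : Fin m → Fin m → Fin m → Fin m) : Set where
  field
    neighbour-adjacent     : ∀ v → AdjRel H v (neighbour v)
    isPerfectMatchingMinus : ∀ v y → AdjRel H v y → IsPerfectMatchingMinus H v y (matchingMinus v y)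

isMatchingCovered? : ∀ {m} (H : Graph m) neighbour matchingMinus →
                     Dec (IsMatchingCovered H neighbour matchingMinus)
isMatchingCovered? H neighbour matchingMinus =
  map′ (λ (a , p) → record { neighbour-adjacent = a ; isPerfectMatchingMinus = p })
       (λ c → IsMatchingCovered.neighbour-adjacent c , IsMatchingCovered.isPerfectMatchingMinus c)
    (all? (λ v → adjacent? H v (neighbour v))
     ×-dec all? (λ v → all? λ y →
             adjacent? H v y →-dec isPerfectMatchingMinus? H v y (matchingMinus v y)))

record MatchingCovered {m} (H : Graph m) : Set where
  field
    neighbour         : Fin m → Fin m
    matchingMinus     : Fin m → Fin m → Fin m → Fin m
    isMatchingCovered : IsMatchingCovered H neighbour matchingMinus

  open IsMatchingCovered isMatchingCovered public

Iso-trans : ∀ {n m k} {G : Graph n} {H : Graph m} {K : Graph k} → Iso G H → Iso H K → Iso G K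
Iso-trans (e , e-adj) (e′ , e′-adj) = ↔-trans e e′ , λ x y → trans (e′-adj _ _) (e-adj x y)

module IsoProperties {n m} (G : Graph n) (H : Graph m) (I : Iso G H) where

  to : Fin n → Fin m
  to = Inverse.to (proj₁ I)

  from : Fin m → Fin n
  from = Inverse.from (proj₁ I)

  from-to : ∀ x → from (to x) ≡ x
  from-to x = Inverse.inverseʳ (proj₁ I) refl

  to-from : ∀ y → to (from y) ≡ y
  to-from y = Inverse.inverseˡ (proj₁ I) refl

  to-injective : ∀ {x y} → to x ≡ to y → x ≡ y
  to-injective {x} {y} p = trans (sym (from-to x)) (trans (cong from p) (from-to y))

  from-injective : ∀ {x y} → from x ≡ from y → x ≡ y
  from-injective {x} {y} p = trans (sym (to-from x)) (trans (cong to p) (to-from y))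

  adj-to : ∀ x y → adj H (to x) (to y) ≡ adj G x y
  adj-to = proj₂ I

  adj-from : ∀ x y → adj G (from x) (from y) ≡ adj H x y
  adj-from x y = trans (sym (adj-to (from x) (from y))) (cong₂ (adj H) (to-from x) (to-from y))

  AdjRel-to : ∀ {x y} → AdjRel G x y → AdjRel H (to x) (to y)
  AdjRel-to {x} {y} xy = trans (adj-to x y) xy

  AdjRel-from : ∀ {x y} → AdjRel H x y → AdjRel G (from x) (from y)
  AdjRel-from {x} {y} xy = trans (adj-from x y) xy

  conjugate : (Fin m → Fin m) → Fin n → Fin n
  conjugate μ = from ∘ μ ∘ to

  conjugate-fixed : ∀ μ {x} → conjugate μ x ≡ x → μ (to x) ≡ to x
  conjugate-fixed μ {x} p = trans (sym (to-from _)) (cong to p)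

  AdjRel-back : ∀ {x y} → AdjRel H (to x) y → AdjRel G x (from y)
  AdjRel-back {x} xy = subst (λ z → AdjRel G z _) (from-to x) (AdjRel-from xy)

  IsMatching-conjugate : ∀ {μ} → IsMatching H μ → IsMatching G (conjugate μ)
  IsMatching-conjugate {μ} M = record
    { involutive = λ x → begin
        from (μ (to (from (μ (to x))))) ≡⟨ cong (from ∘ μ) (to-from _) ⟩
        from (μ (μ (to x)))             ≡⟨ cong from (involutive (to x)) ⟩
        from (to x)                     ≡⟨ from-to x ⟩
        x                               ∎
    ; adjacent   = λ x moved →
        AdjRel-back (adjacent (to x) λ fixed → moved (trans (cong from fixed) (from-to x)))
    }
    where
    open IsMatching M
    open ≡-Reasoning

NearPerfectMatchingCut-transport : ∀ {n m} {G : Graph n} {H : Graph m} →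
                                   Iso G H → NearPerfectMatchingCut H → NearPerfectMatchingCut G
NearPerfectMatchingCut-transport {G = G} {H} I C = record
  { colour   = colour ∘ to
  ; mate     = conjugate mate
  ; exposed₁ = from exposed₁
  ; exposed₂ = from exposed₂
  ; isNearPerfectMatchingCut = record
    { isMatching          = IsMatching-conjugate isMatching
    ; fixed⇒exposed       = λ x fixed →
        Sum.map (back x) (back x) (fixed⇒exposed (to x) (conjugate-fixed mate fixed))
    ; bichromatic⇒matched = λ x y xy x≁y →
        trans (cong from (bichromatic⇒matched (to x) (to y) (AdjRel-to xy) x≁y)) (from-to y)
    ; bichromatic-edge    = let (x , y , xy , x≁y) = bichromatic-edge in
        from x , from y , AdjRel-from xy ,
        λ p → x≁y (trans (sym (cong colour (to-from x))) (trans p (cong colour (to-from y))))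
    }
  }
  where
  open IsoProperties G H I
  open NearPerfectMatchingCut C
  back : ∀ x {e} → to x ≡ e → x ≡ from e
  back x p = trans (sym (from-to x)) (cong from p)

MatchingCovered-transport : ∀ {n m} {G : Graph n} {H : Graph m} →
                            Iso G H → MatchingCovered H → MatchingCovered G
MatchingCovered-transport {G = G} {H} I C = record
  { neighbour         = λ v → from (neighbour (to v))
  ; matchingMinus     = λ v y → conjugate (matchingMinus (to v) (to y))
  ; isMatchingCovered = record
    { neighbour-adjacent     = λ v → AdjRel-back (neighbour-adjacent (to v))
    ; isPerfectMatchingMinus = λ v y vy → perfect v y (isPerfectMatchingMinus (to v) (to y) (AdjRel-to vy))
    }
  }
  where
  open IsoProperties G H I
  open MatchingCovered C
  perfect : ∀ v y {μ} → IsPerfectMatchingMinus H (to v) (to y) μ → IsPerfectMatchingMinus G v y (conjugate μ)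
  perfect v y {μ} P = record
    { isMatching     = IsMatching-conjugate isMatching
    ; v-exposed      = trans (cong from v-exposed) (from-to v)
    ; y-exposed      = trans (cong from y-exposed) (from-to y)
    ; others-covered = λ x x≢v x≢y fixed →
        others-covered (to x) (x≢v ∘ to-injective) (x≢y ∘ to-injective) (conjugate-fixed μ fixed)
    }
    where open IsPerfectMatchingMinus P

-- Star products

module StarProduct {n₁ n₂ n} {G₁ : Graph n₁} {u : Fin n₁} {G₂ : Graph n₂} {v : Fin n₂} {G : Graph n}
                   (S : IsStarProduct G₁ u G₂ v G) where
  open IsStarProduct S public

  data View : Fin n → Set where
    left  : ∀ x → x ≢ u → View (f x)
    right : ∀ y → y ≢ v → View (g y)

  view : ∀ w → View w
  view w with cover w
  ... | inj₁ (x , x≢u , refl) = left x x≢u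
  ... | inj₂ (y , y≢v , refl) = right y y≢v

  either : ∀ {A : Set} → (Fin n₁ → A) → (Fin n₂ → A) → Fin n → A
  either F H w = [ F ∘ proj₁ , H ∘ proj₁ ] (cover w)

  either-f : ∀ {A : Set} (F : Fin n₁ → A) (H : Fin n₂ → A) {x} →
             x ≢ u → either F H (f x) ≡ F x
  either-f F H {x} x≢u with cover (f x)
  ... | inj₁ (x′ , x′≢u , p) = cong F (f-inj x′ x x′≢u x≢u p)
  ... | inj₂ (y , y≢v , p)   = ⊥-elim (disjoint x y x≢u y≢v (sym p))

  either-g : ∀ {A : Set} (F : Fin n₁ → A) (H : Fin n₂ → A) {y} →
             y ≢ v → either F H (g y) ≡ H y
  either-g F H {y} y≢v with cover (g y)
  ... | inj₁ (x , x≢u , p)   = ⊥-elim (disjoint x y x≢u y≢v p)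
  ... | inj₂ (y′ , y′≢v , p) = cong H (g-inj y′ y y′≢v y≢v p)

  AdjRel-f : ∀ {x x′} → x ≢ u → x′ ≢ u → AdjRel G₁ x x′ → AdjRel G (f x) (f x′)
  AdjRel-f x≢u x′≢u xx′ = trans (adj₁ _ _ x≢u x′≢u) xx′

  AdjRel-g : ∀ {y y′} → y ≢ v → y′ ≢ v → AdjRel G₂ y y′ → AdjRel G (g y) (g y′)
  AdjRel-g y≢v y′≢v yy′ = trans (adj₂ _ _ y≢v y′≢v) yy′

  f-partner-unique : ∀ {x x′ y} → x ≢ u → x′ ≢ u → y ≢ v →
                     AdjRel G (f x) (g y) → AdjRel G (f x′) (g y) → x ≡ x′
  f-partner-unique {x} {x′} {y} x≢u x′≢u y≢v xy x′y =
    let (_ , _ , _ , unique) = cross-right y (proj₂ (cross-sound x y x≢u y≢v xy)) in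
    trans (unique x x≢u xy) (sym (unique x′ x′≢u x′y))

  g-partner-unique : ∀ {x y y′} → x ≢ u → y ≢ v → y′ ≢ v →
                     AdjRel G (f x) (g y) → AdjRel G (f x) (g y′) → y ≡ y′
  g-partner-unique {x} {y} {y′} x≢u y≢v y′≢v xy xy′ =
    let (_ , _ , _ , unique) = cross-left x (proj₁ (cross-sound x y x≢u y≢v xy)) in
    trans (unique y y≢v xy) (sym (unique y′ y′≢v xy′))

IsStarProduct-swap : ∀ {n₁ n₂ n} {G₁ : Graph n₁} {u} {G₂ : Graph n₂} {v} {G : Graph n} →
                     IsStarProduct G₁ u G₂ v G → IsStarProduct G₂ v G₁ u G
IsStarProduct-swap {G = G} S = record
  { f           = g
  ; g           = f
  ; f-inj       = g-inj
  ; g-inj       = f-inj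
  ; disjoint    = λ y x y≢v x≢u p → disjoint x y x≢u y≢v (sym p)
  ; cover       = Sum.swap ∘ cover
  ; adj₁        = adj₂
  ; adj₂        = adj₁
  ; cross-sound = λ y x y≢v x≢u yx → Product.swap (cross-sound x y x≢u y≢v (AdjRel-sym G yx))
  ; cross-left  = λ y vy → let (x , x≢u , xy , unique) = cross-right y vy in
      x , x≢u , AdjRel-sym G xy , λ x′ x′≢u yx′ → unique x′ x′≢u (AdjRel-sym G yx′)
  ; cross-right = λ x ux → let (y , y≢v , xy , unique) = cross-left x ux in
      y , y≢v , AdjRel-sym G xy , λ y′ y′≢v y′x → unique y′ y′≢v (AdjRel-sym G y′x)
  }
  where open IsStarProduct S

IsStarProduct-transportˡ : ∀ {n₁ m n₂ n} {G₁ : Graph n₁} {F : Graph m} {u} {G₂ : Graph n₂} {v}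
                           {G : Graph n} (I : Iso G₁ F) →
                           IsStarProduct G₁ u G₂ v G → IsStarProduct F (Inverse.to (proj₁ I) u) G₂ v G
IsStarProduct-transportˡ {G₁ = G₁} {F} {u} {G = G} I S = record
  { f           = f ∘ from
  ; g           = g
  ; f-inj       = λ x x′ x≢ x′≢ p → from-injective (f-inj _ _ (from-≢ x≢) (from-≢ x′≢) p)
  ; g-inj       = g-inj
  ; disjoint    = λ x y x≢ y≢v → disjoint (from x) y (from-≢ x≢) y≢v
  ; cover       = λ w →
      Sum.map₁ (λ (x , x≢u , p) → to x , x≢u ∘ to-injective , trans (cong f (from-to x)) p) (cover w)
  ; adj₁        = λ x x′ x≢ x′≢ → trans (adj₁ _ _ (from-≢ x≢) (from-≢ x′≢)) (adj-from x x′)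
  ; adj₂        = adj₂
  ; cross-sound = λ x y x≢ y≢v xy → let (ux , vy) = cross-sound (from x) y (from-≢ x≢) y≢v xy in
                    subst (AdjRel F (to u)) (to-from x) (AdjRel-to ux) , vy
  ; cross-left  = λ x ux →
      cross-left (from x) (subst (λ z → AdjRel G₁ z (from x)) (from-to u) (AdjRel-from ux))
  ; cross-right = λ y vy → let (x , x≢u , xy , unique) = cross-right y vy in
      to x , x≢u ∘ to-injective , subst (λ z → AdjRel G (f z) (g y)) (sym (from-to x)) xy ,
      λ x′ x′≢ x′y → trans (sym (to-from x′)) (cong to (unique (from x′) (from-≢ x′≢) x′y))
  }
  where
  open IsStarProduct S
  open IsoProperties G₁ F I
  from-≢ : ∀ {x} → x ≢ to u → from x ≢ u
  from-≢ {x} x≢ p = x≢ (trans (sym (to-from x)) (cong to p))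

module StarProductCut {n₁ n₂ n} {G₁ : Graph n₁} {u : Fin n₁} {G₂ : Graph n₂} {v : Fin n₂} {G : Graph n}
                      (C : NearPerfectMatchingCut G₁) (M : MatchingCovered G₂)
                      (S : IsStarProduct G₁ u G₂ v G) where
  open NearPerfectMatchingCut C
  open MatchingCovered M using (neighbour; neighbour-adjacent; matchingMinus; isPerfectMatchingMinus)
  open StarProduct S

  -- The neighbour of v that takes over u's place in the matching: the partner of f (mate u) if u is
  -- matched, an arbitrary neighbour of v otherwise.
  record Heir : Set where
    field
      vertex          : Fin n₂
      vertex≢v        : vertex ≢ v
      v-adjacent      : AdjRel G₂ v vertex
      crossing        : mate u ≢ u → AdjRel G (f (mate u)) (g vertex)
      crossing-unique : mate u ≢ u → ∀ z → z ≢ v → AdjRel G (f (mate u)) (g z) → z ≡ vertex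

  heir : Heir
  heir with mate u ≟ u
  ... | yes fixed = record
    { vertex          = neighbour v
    ; vertex≢v        = λ p → AdjRel⇒≢ G₂ (neighbour-adjacent v) (sym p)
    ; v-adjacent      = neighbour-adjacent v
    ; crossing        = λ moved → ⊥-elim (moved fixed)
    ; crossing-unique = λ moved → ⊥-elim (moved fixed)
    }
  ... | no moved with cross-left (mate u) (adjacent u moved)
  ...   | z , z≢v , cross , unique = record
    { vertex          = z
    ; vertex≢v        = z≢v
    ; v-adjacent      = proj₂ (cross-sound (mate u) z moved z≢v cross)
    ; crossing        = λ _ → cross
    ; crossing-unique = λ _ → unique
    }

  open Heir heir renaming (vertex to y; vertex≢v to y≢v)

  μ : Fin n₂ → Fin n₂
  μ = matchingMinus v y

  open IsPerfectMatchingMinus (isPerfectMatchingMinus v y v-adjacent) using ()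
    renaming (involutive to μ-involutive; adjacent to μ-adjacent; injective to μ-injective;
              v-exposed to μ-v; y-exposed to μ-y; others-covered to μ-covers)

  μ-≢v : ∀ {z} → z ≢ v → μ z ≢ v
  μ-≢v z≢v p = z≢v (μ-injective (trans p (sym μ-v)))

  μ-≢y : ∀ {z} → z ≢ y → μ z ≢ y
  μ-≢y z≢y p = z≢y (μ-injective (trans p (sym μ-y)))

  -- V(G) splits into embed (V(G₁)), with u represented by g y, and g (V(G₂) − v − y); the new
  -- matching is mate on the first part and μ on the second, the new colouring that of u on G₂.
  embed : Fin n₁ → Fin n
  embed x with x ≟ u
  ... | yes _ = g y
  ... | no _  = f x

  embed-u : embed u ≡ g y
  embed-u with u ≟ u
  ... | yes _  = refl
  ... | no u≢u = ⊥-elim (u≢u refl)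

  embed-f : ∀ {x} → x ≢ u → embed x ≡ f x
  embed-f {x} x≢u with x ≟ u
  ... | yes x≡u = ⊥-elim (x≢u x≡u)
  ... | no _    = refl

  embed-injective : ∀ {x x′} → embed x ≡ embed x′ → x ≡ x′
  embed-injective {x} {x′} p with x ≟ u | x′ ≟ u
  ... | yes x≡u | yes x′≡u = trans x≡u (sym x′≡u)
  ... | yes _   | no x′≢u  = ⊥-elim (disjoint x′ y x′≢u y≢v (sym p))
  ... | no x≢u  | yes _    = ⊥-elim (disjoint x y x≢u y≢v p)
  ... | no x≢u  | no x′≢u  = f-inj x x′ x≢u x′≢u p

  project-g : Fin n₂ → Fin n₁ ⊎ Fin n₂
  project-g z with z ≟ y
  ... | yes _ = inj₁ u
  ... | no _  = inj₂ z

  project : Fin n → Fin n₁ ⊎ Fin n₂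
  project = either inj₁ project-g

  project-embed : ∀ x → project (embed x) ≡ inj₁ x
  project-embed x with x ≟ u
  ... | no x≢u     = either-f inj₁ project-g x≢u
  ... | yes refl with y ≟ y | either-g inj₁ project-g y≢v
  ...   | yes _ | p = p
  ...   | no y≢y | _ = ⊥-elim (y≢y refl)

  project-inner : ∀ {z} → z ≢ v → z ≢ y → project (g z) ≡ inj₂ z
  project-inner {z} z≢v z≢y with z ≟ y | either-g inj₁ project-g z≢v
  ... | yes z≡y | _ = ⊥-elim (z≢y z≡y)
  ... | no _    | p = p

  data Part : Fin n → Set where
    image : ∀ x → Part (embed x)
    inner : ∀ z → z ≢ v → z ≢ y → Part (g z)

  part : ∀ w → Part w
  part w with view w
  ... | left x x≢u = subst Part (embed-f x≢u) (image x)
  ... | right z z≢v with z ≟ y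
  ...   | yes refl = subst Part embed-u (image u)
  ...   | no z≢y   = inner z z≢v z≢y

  mate′ : Fin n → Fin n
  mate′ = [ embed ∘ mate , g ∘ μ ] ∘ project

  colour′ : Fin n → Fin 2
  colour′ = [ colour , (λ _ → colour u) ] ∘ project

  mate′-embed : ∀ x → mate′ (embed x) ≡ embed (mate x)
  mate′-embed x = cong [ embed ∘ mate , g ∘ μ ] (project-embed x)

  mate′-inner : ∀ {z} → z ≢ v → z ≢ y → mate′ (g z) ≡ g (μ z)
  mate′-inner z≢v z≢y = cong [ embed ∘ mate , g ∘ μ ] (project-inner z≢v z≢y)

  colour′-embed : ∀ x → colour′ (embed x) ≡ colour x
  colour′-embed x = cong [ colour , (λ _ → colour u) ] (project-embed x)

  colour′-f : ∀ {x} → x ≢ u → colour′ (f x) ≡ colour x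
  colour′-f {x} x≢u = subst (λ w → colour′ w ≡ colour x) (embed-f x≢u) (colour′-embed x)

  colour′-g : ∀ {z} → z ≢ v → colour′ (g z) ≡ colour u
  colour′-g {z} z≢v with z ≟ y
  ... | yes refl = subst (λ w → colour′ w ≡ colour u) embed-u (colour′-embed u)
  ... | no z≢y   = cong [ colour , (λ _ → colour u) ] (project-inner z≢v z≢y)

  embed-adjacent : ∀ x → mate x ≢ x → AdjRel G (embed x) (embed (mate x))
  embed-adjacent x moved with x ≟ u | mate x ≟ u
  ... | yes refl | yes mu≡u = ⊥-elim (moved mu≡u)
  ... | yes refl | no mu≢u  = AdjRel-sym G (crossing mu≢u)
  ... | no x≢u   | yes mx≡u =
    subst (λ z → AdjRel G (f z) (g y)) mu≡x (crossing λ mu≡u → x≢u (trans (sym mu≡x) mu≡u))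
    where
    mu≡x : mate u ≡ x
    mu≡x = trans (cong mate (sym mx≡u)) (involutive x)
  ... | no x≢u   | no mx≢u  = AdjRel-f x≢u mx≢u (adjacent x moved)

  involutive′ : ∀ w → mate′ (mate′ w) ≡ w
  involutive′ w with part w
  ... | image x =
    trans (cong mate′ (mate′-embed x)) (trans (mate′-embed (mate x)) (cong embed (involutive x)))
  ... | inner z z≢v z≢y = trans (cong mate′ (mate′-inner z≢v z≢y))
                            (trans (mate′-inner (μ-≢v z≢v) (μ-≢y z≢y)) (cong g (μ-involutive z)))

  adjacent′ : ∀ w → mate′ w ≢ w → AdjRel G w (mate′ w)
  adjacent′ w moved with part w
  ... | image x = subst (AdjRel G (embed x)) (sym (mate′-embed x))
                    (embed-adjacent x λ fixed → moved (trans (mate′-embed x) (cong embed fixed)))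
  ... | inner z z≢v z≢y = subst (AdjRel G (g z)) (sym (mate′-inner z≢v z≢y))
                            (AdjRel-g z≢v (μ-≢v z≢v) (μ-adjacent z (μ-covers z z≢v z≢y)))

  fixed⇒exposed′ : ∀ w → mate′ w ≡ w → w ≡ embed exposed₁ ⊎ w ≡ embed exposed₂
  fixed⇒exposed′ w fixed with part w
  ... | image x = Sum.map (cong embed) (cong embed)
                    (fixed⇒exposed x (embed-injective (trans (sym (mate′-embed x)) fixed)))
  ... | inner z z≢v z≢y = ⊥-elim (μ-covers z z≢v z≢y
                            (g-inj _ _ (μ-≢v z≢v) z≢v (trans (sym (mate′-inner z≢v z≢y)) fixed)))

  mate′-f : ∀ {x} → x ≢ u → mate′ (f x) ≡ embed (mate x)
  mate′-f {x} x≢u = trans (cong mate′ (sym (embed-f x≢u))) (mate′-embed x)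

  -- A bichromatic edge between the two sides comes from the bichromatic edge u (mate u) of G₁.
  cross-bichromatic : ∀ {x z} → x ≢ u → z ≢ v → AdjRel G (f x) (g z) → colour x ≢ colour u →
                      mate x ≡ u × z ≡ y
  cross-bichromatic {x} {z} x≢u z≢v xz x≁u =
    trans (cong mate (sym mu≡x)) (involutive u) ,
    crossing-unique mu≢u z z≢v (subst (λ x′ → AdjRel G (f x′) (g z)) (sym mu≡x) xz)
    where
    mu≡x : mate u ≡ x
    mu≡x = bichromatic⇒matched u x (proj₁ (cross-sound x z x≢u z≢v xz)) (x≁u ∘ sym)
    mu≢u : mate u ≢ u
    mu≢u p = x≢u (trans (sym mu≡x) p)

  bichromatic⇒matched′ : ∀ w w′ → AdjRel G w w′ → colour′ w ≢ colour′ w′ → mate′ w ≡ w′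
  bichromatic⇒matched′ w w′ ww′ w≁w′ with view w | view w′
  ... | left x x≢u | left x′ x′≢u =
    trans (mate′-f x≢u) (trans (cong embed mx≡x′) (embed-f x′≢u))
    where
    mx≡x′ : mate x ≡ x′
    mx≡x′ = bichromatic⇒matched x x′ (trans (sym (adj₁ x x′ x≢u x′≢u)) ww′)
              λ p → w≁w′ (trans (colour′-f x≢u) (trans p (sym (colour′-f x′≢u))))
  ... | left x x≢u | right z z≢v
    with cross-bichromatic x≢u z≢v ww′ (λ p → w≁w′ (trans (colour′-f x≢u) (trans p (sym (colour′-g z≢v)))))
  ...   | mx≡u , refl = trans (mate′-f x≢u) (trans (cong embed mx≡u) embed-u)
  bichromatic⇒matched′ w w′ ww′ w≁w′ | right z z≢v | left x x≢u
    with cross-bichromatic x≢u z≢v (AdjRel-sym G ww′)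
           (λ p → w≁w′ (trans (colour′-g z≢v) (trans (sym p) (sym (colour′-f x≢u)))))
  ...   | mx≡u , refl = trans (cong mate′ (sym embed-u))
                          (trans (mate′-embed u) (trans (cong embed mu≡x) (embed-f x≢u)))
    where
    mu≡x : mate u ≡ x
    mu≡x = trans (cong mate (sym mx≡u)) (involutive x)
  bichromatic⇒matched′ w w′ ww′ w≁w′ | right z z≢v | right z′ z′≢v =
    ⊥-elim (w≁w′ (trans (colour′-g z≢v) (sym (colour′-g z′≢v))))

  lift-edge : ∀ {x x′} → AdjRel G₁ x x′ →
              ∃₂ λ w w′ → AdjRel G w w′ × colour′ w ≡ colour x × colour′ w′ ≡ colour x′
  lift-edge {x} {x′} xx′ with x ≟ u | x′ ≟ u
  ... | yes refl | yes refl = ⊥-elim (AdjRel⇒≢ G₁ xx′ refl)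
  ... | yes refl | no x′≢u  = let (z , z≢v , x′z , _) = cross-left x′ xx′ in
                              g z , f x′ , AdjRel-sym G x′z , colour′-g z≢v , colour′-f x′≢u
  ... | no x≢u   | yes refl = let (z , z≢v , xz , _) = cross-left x (AdjRel-sym G₁ xx′) in
                              f x , g z , xz , colour′-f x≢u , colour′-g z≢v
  ... | no x≢u   | no x′≢u  = f x , f x′ , AdjRel-f x≢u x′≢u xx′ , colour′-f x≢u , colour′-f x′≢u

  bichromatic-edge′ : ∃₂ λ w w′ → AdjRel G w w′ × colour′ w ≢ colour′ w′
  bichromatic-edge′ =
    let (x , x′ , xx′ , x≁x′) = bichromatic-edge
        (w , w′ , ww′ , cw , cw′) = lift-edge xx′
    in w , w′ , ww′ , λ p → x≁x′ (trans (sym cw) (trans p cw′))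

  nearPerfectMatchingCut : NearPerfectMatchingCut G
  nearPerfectMatchingCut = record
    { colour   = colour′
    ; mate     = mate′
    ; exposed₁ = embed exposed₁
    ; exposed₂ = embed exposed₂
    ; isNearPerfectMatchingCut = record
      { isMatching          = record { involutive = involutive′ ; adjacent = adjacent′ }
      ; fixed⇒exposed       = fixed⇒exposed′
      ; bichromatic⇒matched = bichromatic⇒matched′
      ; bichromatic-edge    = bichromatic-edge′
      }
    }

NearPerfectMatchingCut-starProduct : ∀ {n₁ n₂ n} {G₁ : Graph n₁} {u} {G₂ : Graph n₂} {v} {G : Graph n} →
                                     NearPerfectMatchingCut G₁ → MatchingCovered G₂ →
                                     IsStarProduct G₁ u G₂ v G → NearPerfectMatchingCut G
NearPerfectMatchingCut-starProduct = StarProductCut.nearPerfectMatchingCut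

-- Star products with K₃,₃

record IsNeighbourEnumeration {n} (G : Graph n) (neighbours : Fin n → Fin 3 → Fin n) : Set where
  field
    neighbours-adjacent   : ∀ u i → AdjRel G u (neighbours u i)
    neighbours-injective  : ∀ u i j → neighbours u i ≡ neighbours u j → i ≡ j
    neighbours-surjective : ∀ u x → AdjRel G u x → ∃ λ i → neighbours u i ≡ x

isNeighbourEnumeration? : ∀ {n} (G : Graph n) neighbours → Dec (IsNeighbourEnumeration G neighbours)
isNeighbourEnumeration? G neighbours =
  map′ (λ (a , i , s) → record
          { neighbours-adjacent = a ; neighbours-injective = i ; neighbours-surjective = s })
       (λ e → let open IsNeighbourEnumeration e in
          neighbours-adjacent , neighbours-injective , neighbours-surjective)
    (all? (λ u → all? λ i → adjacent? G u (neighbours u i))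
     ×-dec all? (λ u → all? λ i → all? λ j → neighbours u i ≟ neighbours u j →-dec i ≟ j)
     ×-dec all? (λ u → all? λ x → adjacent? G u x →-dec any? λ i → neighbours u i ≟ x))

record Cubic {n} (G : Graph n) : Set where
  field
    neighbours             : Fin n → Fin 3 → Fin n
    isNeighbourEnumeration : IsNeighbourEnumeration G neighbours

  open IsNeighbourEnumeration isNeighbourEnumeration public

-- G with u replaced by a copy of K₂,₃: its degree-2 vertices inj₂ (suc i) take over the edges
-- from u to ν i, and its degree-3 vertices are inj₂ zero and u itself, now detached from G.
module Inflation {n} (G : Graph n) (u : Fin n) (ν : Fin 3 → Fin n) where

  isU : Fin n → Bool
  isU x = does (x ≟ u)

  adjᴵ : Fin n ⊎ Fin 4 → Fin n ⊎ Fin 4 → Bool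
  adjᴵ (inj₁ x)       (inj₁ y)       = not (isU x ∨ isU y) ∧ adj G x y
  adjᴵ (inj₁ x)       (inj₂ zero)    = false
  adjᴵ (inj₁ x)       (inj₂ (suc i)) = isU x ∨ does (x ≟ ν i)
  adjᴵ (inj₂ zero)    (inj₁ y)       = false
  adjᴵ (inj₂ (suc i)) (inj₁ y)       = isU y ∨ does (y ≟ ν i)
  adjᴵ (inj₂ zero)    (inj₂ zero)    = false
  adjᴵ (inj₂ zero)    (inj₂ (suc _)) = true
  adjᴵ (inj₂ (suc _)) (inj₂ zero)    = true
  adjᴵ (inj₂ (suc _)) (inj₂ (suc _)) = false

  adjᴵ-sym : ∀ p q → adjᴵ p q ≡ adjᴵ q p
  adjᴵ-sym (inj₁ x)       (inj₁ y)       =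
    cong₂ (λ a b → not a ∧ b) (∨-comm (isU x) (isU y)) (adj-sym G x y)
  adjᴵ-sym (inj₁ x)       (inj₂ zero)    = refl
  adjᴵ-sym (inj₁ x)       (inj₂ (suc i)) = refl
  adjᴵ-sym (inj₂ zero)    (inj₁ y)       = refl
  adjᴵ-sym (inj₂ (suc i)) (inj₁ y)       = refl
  adjᴵ-sym (inj₂ zero)    (inj₂ zero)    = refl
  adjᴵ-sym (inj₂ zero)    (inj₂ (suc _)) = refl
  adjᴵ-sym (inj₂ (suc _)) (inj₂ zero)    = refl
  adjᴵ-sym (inj₂ (suc _)) (inj₂ (suc _)) = refl

  adjᴵ-irrefl : ∀ p → adjᴵ p p ≡ false
  adjᴵ-irrefl (inj₁ x)       = trans (cong (not (isU x ∨ isU x) ∧_) (irrefl G x)) (∧-zeroʳ _)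
  adjᴵ-irrefl (inj₂ zero)    = refl
  adjᴵ-irrefl (inj₂ (suc _)) = refl

  graph : Graph (n + 4)
  graph = record
    { adj    = λ w w′ → adjᴵ (splitAt n w) (splitAt n w′)
    ; sym    = λ w w′ → adjᴵ-sym (splitAt n w) (splitAt n w′)
    ; irrefl = λ w → adjᴵ-irrefl (splitAt n w)
    }

  isU-u : isU u ≡ true
  isU-u = dec-true (u ≟ u) refl

  isU-≢ : ∀ {x} → x ≢ u → isU x ≡ false
  isU-≢ {x} = dec-false (x ≟ u)

  adjᴵ-outside : ∀ {x y} → x ≢ u → y ≢ u → adjᴵ (inj₁ x) (inj₁ y) ≡ adj G x y
  adjᴵ-outside {x} {y} x≢u y≢u =
    cong₂ (λ a b → not (a ∨ b) ∧ adj G x y) (isU-≢ x≢u) (isU-≢ y≢u)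

  adjᴵ-detached : ∀ x → adjᴵ (inj₁ x) (inj₁ u) ≡ false
  adjᴵ-detached x = cong (λ b → not b ∧ adj G x u) (trans (cong (isU x ∨_) isU-u) (∨-zeroʳ (isU x)))

  adjᴵ-u-spoke : ∀ i → adjᴵ (inj₁ u) (inj₂ (suc i)) ≡ true
  adjᴵ-u-spoke i = cong (_∨ does (u ≟ ν i)) isU-u

  adjᴵ-outside-spoke : ∀ {x} i → x ≢ u → adjᴵ (inj₁ x) (inj₂ (suc i)) ≡ does (x ≟ ν i)
  adjᴵ-outside-spoke {x} i x≢u = cong (_∨ does (x ≟ ν i)) (isU-≢ x≢u)

inflate : ∀ {n} (G : Graph n) → Cubic G → Fin n → Graph (n + 4)
inflate G cubic u = Inflation.graph G u (Cubic.neighbours cubic u)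

-- Entries are read modulo n.
table : ∀ {k n} .{{_ : NonZero n}} → Vec ℕ k → Fin k → Fin n
table {n = n} t x = lookup t x mod n

cubic : ∀ {n} .{{_ : NonZero n}} (G : Graph n) (t : Vec (Vec ℕ 3) n) →
        {True (isNeighbourEnumeration? G (table ∘ lookup t))} → Cubic G
cubic G t {ok} = record { neighbours = table ∘ lookup t ; isNeighbourEnumeration = toWitness ok }

-- The two other vertices in the part of v.
twin₁ twin₂ : Fin 6 → Fin 6
twin₁ = table (1 ∷ 0 ∷ 0 ∷ 4 ∷ 3 ∷ 3 ∷ [])
twin₂ = table (2 ∷ 2 ∷ 1 ∷ 5 ∷ 5 ∷ 4 ∷ [])

K33-cubic : Cubic K33
K33-cubic = cubic K33 ((3 ∷ 4 ∷ 5 ∷ []) ∷ (3 ∷ 4 ∷ 5 ∷ []) ∷ (3 ∷ 4 ∷ 5 ∷ [])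
                     ∷ (0 ∷ 1 ∷ 2 ∷ []) ∷ (0 ∷ 1 ∷ 2 ∷ []) ∷ (0 ∷ 1 ∷ 2 ∷ []) ∷ [])

K33-bipartite : ∀ v y y′ → adj K33 y y′ ≡ adj K33 v y xor adj K33 v y′
K33-bipartite = from-yes (all? λ v → all? λ y → all? λ y′ →
  adj K33 y y′ ≟ᵇ (adj K33 v y xor adj K33 v y′))

twin₁≢ : ∀ v → twin₁ v ≢ v
twin₁≢ = from-yes (all? λ v → ¬? (twin₁ v ≟ v))

twin₂≢ : ∀ v → twin₂ v ≢ v
twin₂≢ = from-yes (all? λ v → ¬? (twin₂ v ≟ v))

twin₂≢twin₁ : ∀ v → twin₂ v ≢ twin₁ v
twin₂≢twin₁ = from-yes (all? λ v → ¬? (twin₂ v ≟ twin₁ v))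

twin₁-non-adjacent : ∀ v → adj K33 v (twin₁ v) ≡ false
twin₁-non-adjacent = from-yes (all? λ v → adj K33 v (twin₁ v) ≟ᵇ false)

twin₂-non-adjacent : ∀ v → adj K33 v (twin₂ v) ≡ false
twin₂-non-adjacent = from-yes (all? λ v → adj K33 v (twin₂ v) ≟ᵇ false)

K33-non-neighbour : ∀ v y → y ≢ v → adj K33 v y ≡ false → y ≢ twin₁ v → y ≡ twin₂ v
K33-non-neighbour = from-yes (all? λ v → all? λ y →
  ¬? (y ≟ v) →-dec (adj K33 v y ≟ᵇ false →-dec (¬? (y ≟ twin₁ v) →-dec y ≟ twin₂ v)))

module StarProductK33 {n₁ n} {G₁ : Graph n₁} (cubic : Cubic G₁) {u : Fin n₁} {v : Fin 6} {G : Graph n}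
                      (S : IsStarProduct G₁ u K33 v G) where
  open ≡-Reasoning
  open Cubic cubic
  open StarProduct S
  open Inflation G₁ u (neighbours u)

  ν : Fin 3 → Fin n₁
  ν = neighbours u

  ν≢u : ∀ i → ν i ≢ u
  ν≢u i p = AdjRel⇒≢ G₁ (neighbours-adjacent u i) (sym p)

  ≢v : ∀ {y} → AdjRel K33 v y → y ≢ v
  ≢v vy p = AdjRel⇒≢ K33 vy (sym p)

  spoke : Fin 3 → Fin 6
  spoke i = proj₁ (cross-left (ν i) (neighbours-adjacent u i))

  spoke≢v : ∀ i → spoke i ≢ v
  spoke≢v i = proj₁ (proj₂ (cross-left (ν i) (neighbours-adjacent u i)))

  spoke-crossing : ∀ i → AdjRel G (f (ν i)) (g (spoke i))
  spoke-crossing i = proj₁ (proj₂ (proj₂ (cross-left (ν i) (neighbours-adjacent u i))))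

  spoke-adjacent : ∀ i → AdjRel K33 v (spoke i)
  spoke-adjacent i = proj₂ (cross-sound (ν i) (spoke i) (ν≢u i) (spoke≢v i) (spoke-crossing i))

  slot : Fin 6 → Fin 3
  slot y with any? (λ i → adjacent? G (f (ν i)) (g y))
  ... | yes (i , _) = i
  ... | no _        = zero

  slot-crossing : ∀ {y} → AdjRel K33 v y → AdjRel G (f (ν (slot y))) (g y)
  slot-crossing {y} vy with any? (λ i → adjacent? G (f (ν i)) (g y))
  ... | yes (_ , crossing) = crossing
  ... | no none with cross-right y vy
  ...   | x , x≢u , xy , _ with neighbours-surjective u x (proj₁ (cross-sound x y x≢u (≢v vy) xy))
  ...     | i , refl = ⊥-elim (none (i , xy))

  slot-spoke : ∀ i → slot (spoke i) ≡ i
  slot-spoke i = neighbours-injective u _ _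
    (f-partner-unique (ν≢u _) (ν≢u i) (spoke≢v i) (slot-crossing (spoke-adjacent i)) (spoke-crossing i))

  spoke-slot : ∀ {y} → AdjRel K33 v y → spoke (slot y) ≡ y
  spoke-slot vy = g-partner-unique (ν≢u _) (spoke≢v _) (≢v vy) (spoke-crossing _) (slot-crossing vy)

  fromK33 : Fin 6 → Fin n₁ ⊎ Fin 4
  fromK33 y with adj K33 v y | y ≟ twin₁ v
  ... | true  | _     = inj₂ (suc (slot y))
  ... | false | yes _ = inj₁ u
  ... | false | no _  = inj₂ zero

  toᴵ : Fin n → Fin n₁ ⊎ Fin 4
  toᴵ = either inj₁ fromK33

  fromᴵ : Fin n₁ ⊎ Fin 4 → Fin n
  fromᴵ (inj₁ x) with x ≟ u
  ... | yes _ = g (twin₁ v)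
  ... | no _  = f x
  fromᴵ (inj₂ zero)    = g (twin₂ v)
  fromᴵ (inj₂ (suc i)) = g (spoke i)

  fromᴵ-u : fromᴵ (inj₁ u) ≡ g (twin₁ v)
  fromᴵ-u with u ≟ u
  ... | yes _  = refl
  ... | no u≢u = ⊥-elim (u≢u refl)

  fromᴵ-outside : ∀ {x} → x ≢ u → fromᴵ (inj₁ x) ≡ f x
  fromᴵ-outside {x} x≢u with x ≟ u
  ... | yes x≡u = ⊥-elim (x≢u x≡u)
  ... | no _    = refl

  fromᴵ-fromK33 : ∀ {y} → y ≢ v → fromᴵ (fromK33 y) ≡ g y
  fromᴵ-fromK33 {y} y≢v with adj K33 v y in vy | y ≟ twin₁ v
  ... | true  | _        = cong g (spoke-slot vy)
  ... | false | yes refl = fromᴵ-u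
  ... | false | no y≢t₁  = cong g (sym (K33-non-neighbour v y y≢v vy y≢t₁))

  fromK33-twin₁ : fromK33 (twin₁ v) ≡ inj₁ u
  fromK33-twin₁ with adj K33 v (twin₁ v) | twin₁-non-adjacent v | twin₁ v ≟ twin₁ v
  ... | false | _ | yes _   = refl
  ... | false | _ | no t≢t  = ⊥-elim (t≢t refl)

  fromK33-twin₂ : fromK33 (twin₂ v) ≡ inj₂ zero
  fromK33-twin₂ with adj K33 v (twin₂ v) | twin₂-non-adjacent v | twin₂ v ≟ twin₁ v
  ... | false | _ | yes t₂≡t₁ = ⊥-elim (twin₂≢twin₁ v t₂≡t₁)
  ... | false | _ | no _      = refl

  fromK33-spoke : ∀ {y} → AdjRel K33 v y → fromK33 y ≡ inj₂ (suc (slot y))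
  fromK33-spoke {y} vy with adj K33 v y | vy
  ... | true | _ = refl

  toᴵ-f : ∀ {x} → x ≢ u → toᴵ (f x) ≡ inj₁ x
  toᴵ-f = either-f inj₁ fromK33

  toᴵ-g : ∀ {y} → y ≢ v → toᴵ (g y) ≡ fromK33 y
  toᴵ-g = either-g inj₁ fromK33

  from-to : ∀ w → fromᴵ (toᴵ w) ≡ w
  from-to w with view w
  ... | left x x≢u  = trans (cong fromᴵ (toᴵ-f x≢u)) (fromᴵ-outside x≢u)
  ... | right y y≢v = trans (cong fromᴵ (toᴵ-g y≢v)) (fromᴵ-fromK33 y≢v)

  to-from : ∀ c → toᴵ (fromᴵ c) ≡ c
  to-from (inj₁ x) with x ≟ u
  ... | yes refl = trans (toᴵ-g (twin₁≢ v)) fromK33-twin₁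
  ... | no x≢u   = toᴵ-f x≢u
  to-from (inj₂ zero)    = trans (toᴵ-g (twin₂≢ v)) fromK33-twin₂
  to-from (inj₂ (suc i)) = begin
    toᴵ (g (spoke i))             ≡⟨ toᴵ-g (spoke≢v i) ⟩
    fromK33 (spoke i)             ≡⟨ fromK33-spoke (spoke-adjacent i) ⟩
    inj₂ (suc (slot (spoke i)))   ≡⟨ cong (inj₂ ∘ suc) (slot-spoke i) ⟩
    inj₂ (suc i)                  ∎

  not-crossing : ∀ {x y} → x ≢ u → y ≢ v → adj K33 v y ≡ false → adj G (f x) (g y) ≡ false
  not-crossing {x} {y} x≢u y≢v ¬vy = ¬-not crossing⇒⊥
    where
    crossing⇒⊥ : ¬ AdjRel G (f x) (g y)
    crossing⇒⊥ xy with () ← trans (sym ¬vy) (proj₂ (cross-sound x y x≢u y≢v xy))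

  adjᴵ-cross : ∀ {x y} → x ≢ u → y ≢ v → adjᴵ (inj₁ x) (fromK33 y) ≡ adj G (f x) (g y)
  adjᴵ-cross {x} {y} x≢u y≢v with adj K33 v y in vy | y ≟ twin₁ v
  ... | true  | _     = trans (adjᴵ-outside-spoke (slot y) x≢u) (crossing? (x ≟ ν (slot y)))
    where
    crossing? : (d : Dec (x ≡ ν (slot y))) → does d ≡ adj G (f x) (g y)
    crossing? (yes refl) = sym (slot-crossing vy)
    crossing? (no x≢)    =
      sym (¬-not λ xy → x≢ (f-partner-unique x≢u (ν≢u _) y≢v xy (slot-crossing vy)))
  ... | false | yes _ = trans (adjᴵ-detached x) (sym (not-crossing x≢u y≢v vy))
  ... | false | no _  = sym (not-crossing x≢u y≢v vy)

  adjᴵ-fromK33 : ∀ y y′ → adjᴵ (fromK33 y) (fromK33 y′) ≡ adj K33 v y xor adj K33 v y′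
  adjᴵ-fromK33 y y′ with adj K33 v y | y ≟ twin₁ v | adj K33 v y′ | y′ ≟ twin₁ v
  ... | true  | _     | true  | _     = refl
  ... | true  | _     | false | yes _ = adjᴵ-u-spoke (slot y)
  ... | true  | _     | false | no _  = refl
  ... | false | yes _ | true  | _     = adjᴵ-u-spoke (slot y′)
  ... | false | yes _ | false | yes _ = adjᴵ-detached u
  ... | false | yes _ | false | no _  = refl
  ... | false | no _  | true  | _     = refl
  ... | false | no _  | false | yes _ = refl
  ... | false | no _  | false | no _  = refl

  adjᴵ-toᴵ : ∀ w w′ → adjᴵ (toᴵ w) (toᴵ w′) ≡ adj G w w′
  adjᴵ-toᴵ w w′ with view w | view w′
  ... | left x x≢u  | left x′ x′≢u = begin
    adjᴵ (toᴵ (f x)) (toᴵ (f x′)) ≡⟨ cong₂ adjᴵ (toᴵ-f x≢u) (toᴵ-f x′≢u) ⟩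
    adjᴵ (inj₁ x) (inj₁ x′)        ≡⟨ adjᴵ-outside x≢u x′≢u ⟩
    adj G₁ x x′                    ≡⟨ sym (adj₁ x x′ x≢u x′≢u) ⟩
    adj G (f x) (f x′)             ∎
  ... | left x x≢u  | right y y≢v  = trans (cong₂ adjᴵ (toᴵ-f x≢u) (toᴵ-g y≢v)) (adjᴵ-cross x≢u y≢v)
  ... | right y y≢v | left x x≢u   = begin
    adjᴵ (toᴵ (g y)) (toᴵ (f x)) ≡⟨ adjᴵ-sym (toᴵ (g y)) (toᴵ (f x)) ⟩
    adjᴵ (toᴵ (f x)) (toᴵ (g y)) ≡⟨ cong₂ adjᴵ (toᴵ-f x≢u) (toᴵ-g y≢v) ⟩
    adjᴵ (inj₁ x) (fromK33 y)    ≡⟨ adjᴵ-cross x≢u y≢v ⟩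
    adj G (f x) (g y)            ≡⟨ adj-sym G (f x) (g y) ⟩
    adj G (g y) (f x)            ∎
  ... | right y y≢v | right y′ y′≢v = begin
    adjᴵ (toᴵ (g y)) (toᴵ (g y′))       ≡⟨ cong₂ adjᴵ (toᴵ-g y≢v) (toᴵ-g y′≢v) ⟩
    adjᴵ (fromK33 y) (fromK33 y′)        ≡⟨ adjᴵ-fromK33 y y′ ⟩
    adj K33 v y xor adj K33 v y′         ≡⟨ sym (K33-bipartite v y y′) ⟩
    adj K33 y y′                         ≡⟨ sym (adj₂ y y′ y≢v y′≢v) ⟩
    adj G (g y) (g y′)                   ∎

  iso : Iso G (inflate G₁ cubic u)
  iso = mk↔ₛ′ (join n₁ 4 ∘ toᴵ) (fromᴵ ∘ splitAt n₁)
          (λ w → trans (cong (join n₁ 4) (to-from (splitAt n₁ w))) (join-splitAt n₁ 4 w))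
          (λ w → trans (cong fromᴵ (splitAt-join n₁ 4 (toᴵ w))) (from-to w))
      , λ w w′ → trans (cong₂ adjᴵ (splitAt-join n₁ 4 (toᴵ w)) (splitAt-join n₁ 4 (toᴵ w′)))
                       (adjᴵ-toᴵ w w′)

matchingTable : ∀ {m} .{{_ : NonZero m}} → List (ℕ × ℕ × Vec ℕ m) → Fin m → Fin m → Fin m → Fin m
matchingTable []                  v y x = x
matchingTable ((a , b , μ) ∷ rest) v y  =
  if ((toℕ v ≡ᵇ a) ∧ (toℕ y ≡ᵇ b)) ∨ ((toℕ v ≡ᵇ b) ∧ (toℕ y ≡ᵇ a))
  then table μ
  else matchingTable rest v y

matchingCovered : ∀ {m} .{{_ : NonZero m}} (H : Graph m) (nb : Vec ℕ m) (μs : List (ℕ × ℕ × Vec ℕ m)) →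
                  {True (isMatchingCovered? H (table nb) (matchingTable μs))} → MatchingCovered H
matchingCovered H nb μs {ok} = record
  { neighbour = table nb ; matchingMinus = matchingTable μs ; isMatchingCovered = toWitness ok }

record CutCertificate (n : ℕ) : Set where
  constructor cutCertificate
  field
    colours mates     : Vec ℕ n
    exposed₁ exposed₂ : ℕ

ValidCut : ∀ {n} .{{_ : NonZero n}} → Graph n → CutCertificate n → Set
ValidCut {n} G (cutCertificate c m e₁ e₂) =
  IsNearPerfectMatchingCut G (table c) (table m) (e₁ mod n) (e₂ mod n)

validCut? : ∀ {n} .{{_ : NonZero n}} (G : Graph n) c → Dec (ValidCut G c)
validCut? {n} G (cutCertificate c m e₁ e₂) =
  isNearPerfectMatchingCut? G (table c) (table m) (e₁ mod n) (e₂ mod n)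

ValidCut⇒cut : ∀ {n} .{{_ : NonZero n}} {G : Graph n} c → ValidCut G c → NearPerfectMatchingCut G
ValidCut⇒cut {n} (cutCertificate c m e₁ e₂) valid = record
  { colour = table c ; mate = table m ; exposed₁ = e₁ mod n ; exposed₂ = e₂ mod n
  ; isNearPerfectMatchingCut = valid }

cut : ∀ {n} .{{_ : NonZero n}} (G : Graph n) c → {True (validCut? G c)} → NearPerfectMatchingCut G
cut G c {ok} = ValidCut⇒cut c (toWitness ok)

record IsoCertificate (n : ℕ) : Set where
  constructor isoCertificate
  field
    to from : Vec ℕ n

ValidIso : ∀ {n} .{{_ : NonZero n}} → Graph n → Graph n → IsoCertificate n → Set
ValidIso G H (isoCertificate t f) =
  (∀ y → table t (table f y) ≡ y) × (∀ x → table f (table t x) ≡ x) ×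
  (∀ x y → adj H (table t x) (table t y) ≡ adj G x y)

validIso? : ∀ {n} .{{_ : NonZero n}} (G H : Graph n) c → Dec (ValidIso G H c)
validIso? G H (isoCertificate t f) =
  all? (λ y → table t (table f y) ≟ y) ×-dec all? (λ x → table f (table t x) ≟ x)
  ×-dec all? (λ x → all? λ y → adj H (table t x) (table t y) ≟ᵇ adj G x y)

ValidIso⇒Iso : ∀ {n} .{{_ : NonZero n}} {G H : Graph n} c → ValidIso G H c → Iso G H
ValidIso⇒Iso (isoCertificate t f) (tf , ft , adj-t) = mk↔ₛ′ (table t) (table f) tf ft , adj-t

Certificate : ℕ → Set
Certificate n = CutCertificate n ⊎ IsoCertificate n

Valid : ∀ {n} .{{_ : NonZero n}} → Graph n → Graph n → Certificate n → Set
Valid G H = [ ValidCut G , ValidIso G H ]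

valid? : ∀ {n} .{{_ : NonZero n}} (G H : Graph n) c → Dec (Valid G H c)
valid? G H (inj₁ c) = validCut? G c
valid? G H (inj₂ c) = validIso? G H c

Valid⇒ : ∀ {n} .{{_ : NonZero n}} {G H : Graph n} c → Valid G H c → NearPerfectMatchingCut G ⊎ Iso G H
Valid⇒                 (inj₁ c) valid = inj₁ (ValidCut⇒cut c valid)
Valid⇒ {G = G} {H = H} (inj₂ c) valid = inj₂ (ValidIso⇒Iso {G = G} {H = H} c valid)

Heawood-cut : NearPerfectMatchingCut Heawood
Heawood-cut = cut Heawood (cutCertificate (1 ∷ 1 ∷ 1 ∷ 1 ∷ 1 ∷ 1 ∷ 0 ∷ 0 ∷ 0 ∷ 0 ∷ 0 ∷ 0 ∷ 0 ∷ 0 ∷ [])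
                                        (13 ∷ 10 ∷ 7 ∷ 12 ∷ 9 ∷ 6 ∷ 5 ∷ 2 ∷ 8 ∷ 4 ∷ 1 ∷ 11 ∷ 3 ∷ 0 ∷ []) 8 11)

K33-matchingCovered : MatchingCovered K33
K33-matchingCovered = matchingCovered K33 (3 ∷ 3 ∷ 3 ∷ 0 ∷ 0 ∷ 0 ∷ [])
  ( (0 , 3 , (0 ∷ 4 ∷ 5 ∷ 3 ∷ 1 ∷ 2 ∷ []))
  ∷ (0 , 4 , (0 ∷ 3 ∷ 5 ∷ 1 ∷ 4 ∷ 2 ∷ []))
  ∷ (0 , 5 , (0 ∷ 3 ∷ 4 ∷ 1 ∷ 2 ∷ 5 ∷ []))
  ∷ (1 , 3 , (4 ∷ 1 ∷ 5 ∷ 3 ∷ 0 ∷ 2 ∷ []))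
  ∷ (1 , 4 , (3 ∷ 1 ∷ 5 ∷ 0 ∷ 4 ∷ 2 ∷ []))
  ∷ (1 , 5 , (3 ∷ 1 ∷ 4 ∷ 0 ∷ 2 ∷ 5 ∷ []))
  ∷ (2 , 3 , (4 ∷ 5 ∷ 2 ∷ 3 ∷ 0 ∷ 1 ∷ []))
  ∷ (2 , 4 , (3 ∷ 5 ∷ 2 ∷ 0 ∷ 4 ∷ 1 ∷ []))
  ∷ (2 , 5 , (3 ∷ 4 ∷ 2 ∷ 0 ∷ 1 ∷ 5 ∷ []))
  ∷ [])

Heawood-matchingCovered : MatchingCovered Heawood
Heawood-matchingCovered = matchingCovered Heawood (1 ∷ 0 ∷ 1 ∷ 2 ∷ 3 ∷ 0 ∷ 5 ∷ 2 ∷ 7 ∷ 4 ∷ 1 ∷ 6 ∷ 3 ∷ 0 ∷ [])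
  ( (0 , 1 , (0 ∷ 1 ∷ 3 ∷ 2 ∷ 5 ∷ 4 ∷ 7 ∷ 6 ∷ 9 ∷ 8 ∷ 11 ∷ 10 ∷ 13 ∷ 12 ∷ []))
  ∷ (0 , 5 , (0 ∷ 2 ∷ 1 ∷ 4 ∷ 3 ∷ 5 ∷ 7 ∷ 6 ∷ 9 ∷ 8 ∷ 11 ∷ 10 ∷ 13 ∷ 12 ∷ []))
  ∷ (0 , 13 , (0 ∷ 2 ∷ 1 ∷ 4 ∷ 3 ∷ 6 ∷ 5 ∷ 8 ∷ 7 ∷ 10 ∷ 9 ∷ 12 ∷ 11 ∷ 13 ∷ []))
  ∷ (1 , 2 , (5 ∷ 1 ∷ 2 ∷ 4 ∷ 3 ∷ 0 ∷ 7 ∷ 6 ∷ 9 ∷ 8 ∷ 11 ∷ 10 ∷ 13 ∷ 12 ∷ []))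
  ∷ (1 , 10 , (5 ∷ 1 ∷ 3 ∷ 2 ∷ 9 ∷ 0 ∷ 7 ∷ 6 ∷ 13 ∷ 4 ∷ 10 ∷ 12 ∷ 11 ∷ 8 ∷ []))
  ∷ (2 , 3 , (1 ∷ 0 ∷ 2 ∷ 3 ∷ 5 ∷ 4 ∷ 7 ∷ 6 ∷ 9 ∷ 8 ∷ 11 ∷ 10 ∷ 13 ∷ 12 ∷ []))
  ∷ (2 , 7 , (1 ∷ 0 ∷ 2 ∷ 4 ∷ 3 ∷ 6 ∷ 5 ∷ 7 ∷ 9 ∷ 8 ∷ 11 ∷ 10 ∷ 13 ∷ 12 ∷ []))
  ∷ (3 , 4 , (1 ∷ 0 ∷ 7 ∷ 3 ∷ 4 ∷ 6 ∷ 5 ∷ 2 ∷ 9 ∷ 8 ∷ 11 ∷ 10 ∷ 13 ∷ 12 ∷ []))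
  ∷ (3 , 12 , (1 ∷ 0 ∷ 7 ∷ 3 ∷ 5 ∷ 4 ∷ 11 ∷ 2 ∷ 13 ∷ 10 ∷ 9 ∷ 6 ∷ 12 ∷ 8 ∷ []))
  ∷ (4 , 5 , (1 ∷ 0 ∷ 3 ∷ 2 ∷ 4 ∷ 5 ∷ 7 ∷ 6 ∷ 9 ∷ 8 ∷ 11 ∷ 10 ∷ 13 ∷ 12 ∷ []))
  ∷ (4 , 9 , (1 ∷ 0 ∷ 3 ∷ 2 ∷ 4 ∷ 6 ∷ 5 ∷ 8 ∷ 7 ∷ 9 ∷ 11 ∷ 10 ∷ 13 ∷ 12 ∷ []))
  ∷ (5 , 6 , (1 ∷ 0 ∷ 3 ∷ 2 ∷ 9 ∷ 5 ∷ 6 ∷ 8 ∷ 7 ∷ 4 ∷ 11 ∷ 10 ∷ 13 ∷ 12 ∷ []))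
  ∷ (6 , 7 , (1 ∷ 0 ∷ 3 ∷ 2 ∷ 5 ∷ 4 ∷ 6 ∷ 7 ∷ 9 ∷ 8 ∷ 11 ∷ 10 ∷ 13 ∷ 12 ∷ []))
  ∷ (6 , 11 , (1 ∷ 0 ∷ 3 ∷ 2 ∷ 5 ∷ 4 ∷ 6 ∷ 8 ∷ 7 ∷ 10 ∷ 9 ∷ 11 ∷ 13 ∷ 12 ∷ []))
  ∷ (7 , 8 , (1 ∷ 0 ∷ 3 ∷ 2 ∷ 5 ∷ 4 ∷ 11 ∷ 7 ∷ 8 ∷ 10 ∷ 9 ∷ 6 ∷ 13 ∷ 12 ∷ []))
  ∷ (8 , 9 , (1 ∷ 0 ∷ 3 ∷ 2 ∷ 5 ∷ 4 ∷ 7 ∷ 6 ∷ 8 ∷ 9 ∷ 11 ∷ 10 ∷ 13 ∷ 12 ∷ []))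
  ∷ (8 , 13 , (1 ∷ 0 ∷ 3 ∷ 2 ∷ 5 ∷ 4 ∷ 7 ∷ 6 ∷ 8 ∷ 10 ∷ 9 ∷ 12 ∷ 11 ∷ 13 ∷ []))
  ∷ (9 , 10 , (1 ∷ 0 ∷ 3 ∷ 2 ∷ 5 ∷ 4 ∷ 7 ∷ 6 ∷ 13 ∷ 9 ∷ 10 ∷ 12 ∷ 11 ∷ 8 ∷ []))
  ∷ (10 , 11 , (1 ∷ 0 ∷ 3 ∷ 2 ∷ 5 ∷ 4 ∷ 7 ∷ 6 ∷ 9 ∷ 8 ∷ 10 ∷ 11 ∷ 13 ∷ 12 ∷ []))
  ∷ (11 , 12 , (1 ∷ 0 ∷ 3 ∷ 2 ∷ 5 ∷ 4 ∷ 7 ∷ 6 ∷ 13 ∷ 10 ∷ 9 ∷ 11 ∷ 12 ∷ 8 ∷ []))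
  ∷ (12 , 13 , (1 ∷ 0 ∷ 3 ∷ 2 ∷ 5 ∷ 4 ∷ 7 ∷ 6 ∷ 9 ∷ 8 ∷ 11 ∷ 10 ∷ 12 ∷ 13 ∷ []))
  ∷ [])

Fbar1-matchingCovered : MatchingCovered Fbar1
Fbar1-matchingCovered = matchingCovered Fbar1 (2 ∷ 2 ∷ 0 ∷ 0 ∷ 0 ∷ 7 ∷ 7 ∷ 2 ∷ 3 ∷ 4 ∷ [])
  ( (0 , 2 , (0 ∷ 3 ∷ 2 ∷ 1 ∷ 9 ∷ 7 ∷ 8 ∷ 5 ∷ 6 ∷ 4 ∷ []))
  ∷ (0 , 3 , (0 ∷ 2 ∷ 1 ∷ 3 ∷ 9 ∷ 7 ∷ 8 ∷ 5 ∷ 6 ∷ 4 ∷ []))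
  ∷ (0 , 4 , (0 ∷ 2 ∷ 1 ∷ 8 ∷ 4 ∷ 7 ∷ 9 ∷ 5 ∷ 3 ∷ 6 ∷ []))
  ∷ (1 , 2 , (3 ∷ 1 ∷ 2 ∷ 0 ∷ 9 ∷ 7 ∷ 8 ∷ 5 ∷ 6 ∷ 4 ∷ []))
  ∷ (1 , 3 , (2 ∷ 1 ∷ 0 ∷ 3 ∷ 9 ∷ 7 ∷ 8 ∷ 5 ∷ 6 ∷ 4 ∷ []))
  ∷ (1 , 4 , (2 ∷ 1 ∷ 0 ∷ 8 ∷ 4 ∷ 7 ∷ 9 ∷ 5 ∷ 3 ∷ 6 ∷ []))
  ∷ (2 , 7 , (3 ∷ 4 ∷ 2 ∷ 0 ∷ 1 ∷ 8 ∷ 9 ∷ 7 ∷ 5 ∷ 6 ∷ []))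
  ∷ (3 , 8 , (2 ∷ 4 ∷ 0 ∷ 3 ∷ 1 ∷ 7 ∷ 9 ∷ 5 ∷ 8 ∷ 6 ∷ []))
  ∷ (4 , 9 , (2 ∷ 3 ∷ 0 ∷ 1 ∷ 4 ∷ 7 ∷ 8 ∷ 5 ∷ 6 ∷ 9 ∷ []))
  ∷ (5 , 7 , (2 ∷ 3 ∷ 0 ∷ 1 ∷ 9 ∷ 5 ∷ 8 ∷ 7 ∷ 6 ∷ 4 ∷ []))
  ∷ (5 , 8 , (2 ∷ 3 ∷ 0 ∷ 1 ∷ 9 ∷ 5 ∷ 7 ∷ 6 ∷ 8 ∷ 4 ∷ []))
  ∷ (5 , 9 , (2 ∷ 4 ∷ 0 ∷ 8 ∷ 1 ∷ 5 ∷ 7 ∷ 6 ∷ 3 ∷ 9 ∷ []))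
  ∷ (6 , 7 , (2 ∷ 3 ∷ 0 ∷ 1 ∷ 9 ∷ 8 ∷ 6 ∷ 7 ∷ 5 ∷ 4 ∷ []))
  ∷ (6 , 8 , (2 ∷ 3 ∷ 0 ∷ 1 ∷ 9 ∷ 7 ∷ 6 ∷ 5 ∷ 8 ∷ 4 ∷ []))
  ∷ (6 , 9 , (2 ∷ 4 ∷ 0 ∷ 8 ∷ 1 ∷ 7 ∷ 6 ∷ 5 ∷ 3 ∷ 9 ∷ []))
  ∷ [])

Fbar2-matchingCovered : MatchingCovered Fbar2
Fbar2-matchingCovered = matchingCovered Fbar2 (1 ∷ 0 ∷ 0 ∷ 0 ∷ 6 ∷ 6 ∷ 1 ∷ 2 ∷ 3 ∷ 11 ∷ 11 ∷ 1 ∷ 2 ∷ 3 ∷ [])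
  ( (0 , 1 , (0 ∷ 1 ∷ 7 ∷ 13 ∷ 6 ∷ 8 ∷ 4 ∷ 2 ∷ 5 ∷ 11 ∷ 12 ∷ 9 ∷ 10 ∷ 3 ∷ []))
  ∷ (0 , 2 , (0 ∷ 6 ∷ 2 ∷ 13 ∷ 7 ∷ 8 ∷ 1 ∷ 4 ∷ 5 ∷ 11 ∷ 12 ∷ 9 ∷ 10 ∷ 3 ∷ []))
  ∷ (0 , 3 , (0 ∷ 6 ∷ 12 ∷ 3 ∷ 7 ∷ 8 ∷ 1 ∷ 4 ∷ 5 ∷ 11 ∷ 13 ∷ 9 ∷ 2 ∷ 10 ∷ []))
  ∷ (1 , 6 , (2 ∷ 1 ∷ 0 ∷ 13 ∷ 7 ∷ 8 ∷ 6 ∷ 4 ∷ 5 ∷ 11 ∷ 12 ∷ 9 ∷ 10 ∷ 3 ∷ []))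
  ∷ (1 , 11 , (2 ∷ 1 ∷ 0 ∷ 8 ∷ 6 ∷ 7 ∷ 4 ∷ 5 ∷ 3 ∷ 12 ∷ 13 ∷ 11 ∷ 9 ∷ 10 ∷ []))
  ∷ (2 , 7 , (1 ∷ 0 ∷ 2 ∷ 13 ∷ 6 ∷ 8 ∷ 4 ∷ 7 ∷ 5 ∷ 11 ∷ 12 ∷ 9 ∷ 10 ∷ 3 ∷ []))
  ∷ (2 , 12 , (1 ∷ 0 ∷ 2 ∷ 8 ∷ 6 ∷ 7 ∷ 4 ∷ 5 ∷ 3 ∷ 11 ∷ 13 ∷ 9 ∷ 12 ∷ 10 ∷ []))
  ∷ (3 , 8 , (1 ∷ 0 ∷ 12 ∷ 3 ∷ 6 ∷ 7 ∷ 4 ∷ 5 ∷ 8 ∷ 11 ∷ 13 ∷ 9 ∷ 2 ∷ 10 ∷ []))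
  ∷ (3 , 13 , (1 ∷ 0 ∷ 7 ∷ 3 ∷ 6 ∷ 8 ∷ 4 ∷ 2 ∷ 5 ∷ 11 ∷ 12 ∷ 9 ∷ 10 ∷ 13 ∷ []))
  ∷ (4 , 6 , (1 ∷ 0 ∷ 7 ∷ 13 ∷ 4 ∷ 8 ∷ 6 ∷ 2 ∷ 5 ∷ 11 ∷ 12 ∷ 9 ∷ 10 ∷ 3 ∷ []))
  ∷ (4 , 7 , (1 ∷ 0 ∷ 12 ∷ 8 ∷ 4 ∷ 6 ∷ 5 ∷ 7 ∷ 3 ∷ 11 ∷ 13 ∷ 9 ∷ 2 ∷ 10 ∷ []))
  ∷ (4 , 8 , (1 ∷ 0 ∷ 7 ∷ 13 ∷ 4 ∷ 6 ∷ 5 ∷ 2 ∷ 8 ∷ 11 ∷ 12 ∷ 9 ∷ 10 ∷ 3 ∷ []))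
  ∷ (5 , 6 , (1 ∷ 0 ∷ 7 ∷ 13 ∷ 8 ∷ 5 ∷ 6 ∷ 2 ∷ 4 ∷ 11 ∷ 12 ∷ 9 ∷ 10 ∷ 3 ∷ []))
  ∷ (5 , 7 , (1 ∷ 0 ∷ 12 ∷ 8 ∷ 6 ∷ 5 ∷ 4 ∷ 7 ∷ 3 ∷ 11 ∷ 13 ∷ 9 ∷ 2 ∷ 10 ∷ []))
  ∷ (5 , 8 , (1 ∷ 0 ∷ 7 ∷ 13 ∷ 6 ∷ 5 ∷ 4 ∷ 2 ∷ 8 ∷ 11 ∷ 12 ∷ 9 ∷ 10 ∷ 3 ∷ []))
  ∷ (9 , 11 , (1 ∷ 0 ∷ 7 ∷ 13 ∷ 6 ∷ 8 ∷ 4 ∷ 2 ∷ 5 ∷ 9 ∷ 12 ∷ 11 ∷ 10 ∷ 3 ∷ []))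
  ∷ (9 , 12 , (1 ∷ 0 ∷ 7 ∷ 13 ∷ 6 ∷ 8 ∷ 4 ∷ 2 ∷ 5 ∷ 9 ∷ 11 ∷ 10 ∷ 12 ∷ 3 ∷ []))
  ∷ (9 , 13 , (1 ∷ 0 ∷ 12 ∷ 8 ∷ 6 ∷ 7 ∷ 4 ∷ 5 ∷ 3 ∷ 9 ∷ 11 ∷ 10 ∷ 2 ∷ 13 ∷ []))
  ∷ (10 , 11 , (1 ∷ 0 ∷ 7 ∷ 13 ∷ 6 ∷ 8 ∷ 4 ∷ 2 ∷ 5 ∷ 12 ∷ 10 ∷ 11 ∷ 9 ∷ 3 ∷ []))
  ∷ (10 , 12 , (1 ∷ 0 ∷ 7 ∷ 13 ∷ 6 ∷ 8 ∷ 4 ∷ 2 ∷ 5 ∷ 11 ∷ 10 ∷ 9 ∷ 12 ∷ 3 ∷ []))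
  ∷ (10 , 13 , (1 ∷ 0 ∷ 12 ∷ 8 ∷ 6 ∷ 7 ∷ 4 ∷ 5 ∷ 3 ∷ 11 ∷ 10 ∷ 9 ∷ 2 ∷ 13 ∷ []))
  ∷ [])

Fbar3-matchingCovered : MatchingCovered Fbar3
Fbar3-matchingCovered = matchingCovered Fbar3 (2 ∷ 2 ∷ 0 ∷ 0 ∷ 0 ∷ 7 ∷ 7 ∷ 5 ∷ 5 ∷ 5 ∷ 12 ∷ 12 ∷ 10 ∷ 10 ∷ 10 ∷ 2 ∷ 3 ∷ 4 ∷ [])
  ( (0 , 2 , (0 ∷ 3 ∷ 2 ∷ 1 ∷ 17 ∷ 7 ∷ 9 ∷ 5 ∷ 16 ∷ 6 ∷ 13 ∷ 14 ∷ 15 ∷ 10 ∷ 11 ∷ 12 ∷ 8 ∷ 4 ∷ []))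
  ∷ (0 , 3 , (0 ∷ 2 ∷ 1 ∷ 3 ∷ 17 ∷ 7 ∷ 9 ∷ 5 ∷ 16 ∷ 6 ∷ 13 ∷ 14 ∷ 15 ∷ 10 ∷ 11 ∷ 12 ∷ 8 ∷ 4 ∷ []))
  ∷ (0 , 4 , (0 ∷ 2 ∷ 1 ∷ 16 ∷ 4 ∷ 7 ∷ 8 ∷ 5 ∷ 6 ∷ 17 ∷ 13 ∷ 14 ∷ 15 ∷ 10 ∷ 11 ∷ 12 ∷ 3 ∷ 9 ∷ []))
  ∷ (1 , 2 , (3 ∷ 1 ∷ 2 ∷ 0 ∷ 17 ∷ 7 ∷ 9 ∷ 5 ∷ 16 ∷ 6 ∷ 13 ∷ 14 ∷ 15 ∷ 10 ∷ 11 ∷ 12 ∷ 8 ∷ 4 ∷ []))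
  ∷ (1 , 3 , (2 ∷ 1 ∷ 0 ∷ 3 ∷ 17 ∷ 7 ∷ 9 ∷ 5 ∷ 16 ∷ 6 ∷ 13 ∷ 14 ∷ 15 ∷ 10 ∷ 11 ∷ 12 ∷ 8 ∷ 4 ∷ []))
  ∷ (1 , 4 , (2 ∷ 1 ∷ 0 ∷ 16 ∷ 4 ∷ 7 ∷ 8 ∷ 5 ∷ 6 ∷ 17 ∷ 13 ∷ 14 ∷ 15 ∷ 10 ∷ 11 ∷ 12 ∷ 3 ∷ 9 ∷ []))
  ∷ (2 , 15 , (3 ∷ 4 ∷ 2 ∷ 0 ∷ 1 ∷ 7 ∷ 8 ∷ 5 ∷ 6 ∷ 17 ∷ 12 ∷ 14 ∷ 10 ∷ 16 ∷ 11 ∷ 15 ∷ 13 ∷ 9 ∷ []))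
  ∷ (3 , 16 , (2 ∷ 4 ∷ 0 ∷ 3 ∷ 1 ∷ 7 ∷ 8 ∷ 5 ∷ 6 ∷ 17 ∷ 13 ∷ 14 ∷ 15 ∷ 10 ∷ 11 ∷ 12 ∷ 16 ∷ 9 ∷ []))
  ∷ (4 , 17 , (2 ∷ 3 ∷ 0 ∷ 1 ∷ 4 ∷ 7 ∷ 9 ∷ 5 ∷ 16 ∷ 6 ∷ 13 ∷ 14 ∷ 15 ∷ 10 ∷ 11 ∷ 12 ∷ 8 ∷ 17 ∷ []))
  ∷ (5 , 7 , (2 ∷ 3 ∷ 0 ∷ 1 ∷ 17 ∷ 5 ∷ 9 ∷ 7 ∷ 16 ∷ 6 ∷ 13 ∷ 14 ∷ 15 ∷ 10 ∷ 11 ∷ 12 ∷ 8 ∷ 4 ∷ []))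
  ∷ (5 , 8 , (2 ∷ 3 ∷ 0 ∷ 1 ∷ 17 ∷ 5 ∷ 9 ∷ 15 ∷ 8 ∷ 6 ∷ 12 ∷ 14 ∷ 10 ∷ 16 ∷ 11 ∷ 7 ∷ 13 ∷ 4 ∷ []))
  ∷ (5 , 9 , (2 ∷ 3 ∷ 0 ∷ 1 ∷ 17 ∷ 5 ∷ 7 ∷ 6 ∷ 16 ∷ 9 ∷ 13 ∷ 14 ∷ 15 ∷ 10 ∷ 11 ∷ 12 ∷ 8 ∷ 4 ∷ []))
  ∷ (6 , 7 , (2 ∷ 3 ∷ 0 ∷ 1 ∷ 17 ∷ 9 ∷ 6 ∷ 7 ∷ 16 ∷ 5 ∷ 13 ∷ 14 ∷ 15 ∷ 10 ∷ 11 ∷ 12 ∷ 8 ∷ 4 ∷ []))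
  ∷ (6 , 8 , (2 ∷ 3 ∷ 0 ∷ 1 ∷ 17 ∷ 9 ∷ 6 ∷ 15 ∷ 8 ∷ 5 ∷ 12 ∷ 14 ∷ 10 ∷ 16 ∷ 11 ∷ 7 ∷ 13 ∷ 4 ∷ []))
  ∷ (6 , 9 , (2 ∷ 3 ∷ 0 ∷ 1 ∷ 17 ∷ 7 ∷ 6 ∷ 5 ∷ 16 ∷ 9 ∷ 13 ∷ 14 ∷ 15 ∷ 10 ∷ 11 ∷ 12 ∷ 8 ∷ 4 ∷ []))
  ∷ (7 , 15 , (2 ∷ 3 ∷ 0 ∷ 1 ∷ 17 ∷ 8 ∷ 9 ∷ 7 ∷ 5 ∷ 6 ∷ 12 ∷ 14 ∷ 10 ∷ 16 ∷ 11 ∷ 15 ∷ 13 ∷ 4 ∷ []))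
  ∷ (8 , 16 , (2 ∷ 3 ∷ 0 ∷ 1 ∷ 17 ∷ 7 ∷ 9 ∷ 5 ∷ 8 ∷ 6 ∷ 13 ∷ 14 ∷ 15 ∷ 10 ∷ 11 ∷ 12 ∷ 16 ∷ 4 ∷ []))
  ∷ (9 , 17 , (2 ∷ 4 ∷ 0 ∷ 16 ∷ 1 ∷ 7 ∷ 8 ∷ 5 ∷ 6 ∷ 9 ∷ 13 ∷ 14 ∷ 15 ∷ 10 ∷ 11 ∷ 12 ∷ 3 ∷ 17 ∷ []))
  ∷ (10 , 12 , (2 ∷ 3 ∷ 0 ∷ 1 ∷ 17 ∷ 8 ∷ 9 ∷ 15 ∷ 5 ∷ 6 ∷ 10 ∷ 14 ∷ 12 ∷ 16 ∷ 11 ∷ 7 ∷ 13 ∷ 4 ∷ []))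
  ∷ (10 , 13 , (2 ∷ 3 ∷ 0 ∷ 1 ∷ 17 ∷ 7 ∷ 9 ∷ 5 ∷ 16 ∷ 6 ∷ 10 ∷ 14 ∷ 15 ∷ 13 ∷ 11 ∷ 12 ∷ 8 ∷ 4 ∷ []))
  ∷ (10 , 14 , (2 ∷ 3 ∷ 0 ∷ 1 ∷ 17 ∷ 7 ∷ 9 ∷ 5 ∷ 16 ∷ 6 ∷ 10 ∷ 13 ∷ 15 ∷ 11 ∷ 14 ∷ 12 ∷ 8 ∷ 4 ∷ []))
  ∷ (11 , 12 , (2 ∷ 3 ∷ 0 ∷ 1 ∷ 17 ∷ 8 ∷ 9 ∷ 15 ∷ 5 ∷ 6 ∷ 14 ∷ 11 ∷ 12 ∷ 16 ∷ 10 ∷ 7 ∷ 13 ∷ 4 ∷ []))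
  ∷ (11 , 13 , (2 ∷ 3 ∷ 0 ∷ 1 ∷ 17 ∷ 7 ∷ 9 ∷ 5 ∷ 16 ∷ 6 ∷ 14 ∷ 11 ∷ 15 ∷ 13 ∷ 10 ∷ 12 ∷ 8 ∷ 4 ∷ []))
  ∷ (11 , 14 , (2 ∷ 3 ∷ 0 ∷ 1 ∷ 17 ∷ 7 ∷ 9 ∷ 5 ∷ 16 ∷ 6 ∷ 13 ∷ 11 ∷ 15 ∷ 10 ∷ 14 ∷ 12 ∷ 8 ∷ 4 ∷ []))
  ∷ (12 , 15 , (2 ∷ 3 ∷ 0 ∷ 1 ∷ 17 ∷ 7 ∷ 9 ∷ 5 ∷ 16 ∷ 6 ∷ 13 ∷ 14 ∷ 12 ∷ 10 ∷ 11 ∷ 15 ∷ 8 ∷ 4 ∷ []))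
  ∷ (13 , 16 , (2 ∷ 3 ∷ 0 ∷ 1 ∷ 17 ∷ 8 ∷ 9 ∷ 15 ∷ 5 ∷ 6 ∷ 12 ∷ 14 ∷ 10 ∷ 13 ∷ 11 ∷ 7 ∷ 16 ∷ 4 ∷ []))
  ∷ (14 , 17 , (2 ∷ 4 ∷ 0 ∷ 16 ∷ 1 ∷ 8 ∷ 9 ∷ 15 ∷ 5 ∷ 6 ∷ 12 ∷ 13 ∷ 10 ∷ 11 ∷ 14 ∷ 7 ∷ 3 ∷ 17 ∷ []))
  ∷ [])

Fbar1-cubic : Cubic Fbar1
Fbar1-cubic = cubic Fbar1
  ((2 ∷ 3 ∷ 4 ∷ []) ∷ (2 ∷ 3 ∷ 4 ∷ []) ∷ (0 ∷ 1 ∷ 7 ∷ []) ∷ (0 ∷ 1 ∷ 8 ∷ []) ∷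
   (0 ∷ 1 ∷ 9 ∷ []) ∷ (7 ∷ 8 ∷ 9 ∷ []) ∷ (7 ∷ 8 ∷ 9 ∷ []) ∷ (2 ∷ 5 ∷ 6 ∷ []) ∷
   (3 ∷ 5 ∷ 6 ∷ []) ∷ (4 ∷ 5 ∷ 6 ∷ []) ∷ [])

Fbar2-cubic : Cubic Fbar2
Fbar2-cubic = cubic Fbar2
  ((1 ∷ 2 ∷ 3 ∷ []) ∷ (0 ∷ 6 ∷ 11 ∷ []) ∷ (0 ∷ 7 ∷ 12 ∷ []) ∷ (0 ∷ 8 ∷ 13 ∷ []) ∷
   (6 ∷ 7 ∷ 8 ∷ []) ∷ (6 ∷ 7 ∷ 8 ∷ []) ∷ (1 ∷ 4 ∷ 5 ∷ []) ∷ (2 ∷ 4 ∷ 5 ∷ []) ∷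
   (3 ∷ 4 ∷ 5 ∷ []) ∷ (11 ∷ 12 ∷ 13 ∷ []) ∷ (11 ∷ 12 ∷ 13 ∷ []) ∷ (1 ∷ 9 ∷ 10 ∷ []) ∷
   (2 ∷ 9 ∷ 10 ∷ []) ∷ (3 ∷ 9 ∷ 10 ∷ []) ∷ [])

Fbar3-cubic : Cubic Fbar3
Fbar3-cubic = cubic Fbar3
  ((2 ∷ 3 ∷ 4 ∷ []) ∷ (2 ∷ 3 ∷ 4 ∷ []) ∷ (0 ∷ 1 ∷ 15 ∷ []) ∷ (0 ∷ 1 ∷ 16 ∷ []) ∷
   (0 ∷ 1 ∷ 17 ∷ []) ∷ (7 ∷ 8 ∷ 9 ∷ []) ∷ (7 ∷ 8 ∷ 9 ∷ []) ∷ (5 ∷ 6 ∷ 15 ∷ []) ∷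
   (5 ∷ 6 ∷ 16 ∷ []) ∷ (5 ∷ 6 ∷ 17 ∷ []) ∷ (12 ∷ 13 ∷ 14 ∷ []) ∷ (12 ∷ 13 ∷ 14 ∷ []) ∷
   (10 ∷ 11 ∷ 15 ∷ []) ∷ (10 ∷ 11 ∷ 16 ∷ []) ∷ (10 ∷ 11 ∷ 17 ∷ []) ∷ (2 ∷ 7 ∷ 12 ∷ []) ∷
   (3 ∷ 8 ∷ 13 ∷ []) ∷ (4 ∷ 9 ∷ 14 ∷ []) ∷ [])

inflate-Fbar0 : ∀ u → NearPerfectMatchingCut (inflate Fbar0 K33-cubic u) ⊎
                    Iso (inflate Fbar0 K33-cubic u) Fbar1
inflate-Fbar0 u = Valid⇒ {H = Fbar1} (lookup certificates u)
  (from-yes (all? λ u → valid? (inflate Fbar0 K33-cubic u) Fbar1 (lookup certificates u)) u)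
  where
  certificates : Vec (Certificate 10) 6
  certificates = inj₂ (isoCertificate (0 ∷ 5 ∷ 6 ∷ 7 ∷ 8 ∷ 9 ∷ 1 ∷ 2 ∷ 3 ∷ 4 ∷ [])
                    (0 ∷ 6 ∷ 7 ∷ 8 ∷ 9 ∷ 1 ∷ 2 ∷ 3 ∷ 4 ∷ 5 ∷ []))
    ∷ inj₂ (isoCertificate (0 ∷ 5 ∷ 1 ∷ 2 ∷ 3 ∷ 4 ∷ 6 ∷ 7 ∷ 8 ∷ 9 ∷ [])
                    (0 ∷ 2 ∷ 3 ∷ 4 ∷ 5 ∷ 1 ∷ 6 ∷ 7 ∷ 8 ∷ 9 ∷ []))
    ∷ inj₂ (isoCertificate (0 ∷ 1 ∷ 5 ∷ 2 ∷ 3 ∷ 4 ∷ 6 ∷ 7 ∷ 8 ∷ 9 ∷ [])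
                    (0 ∷ 1 ∷ 3 ∷ 4 ∷ 5 ∷ 2 ∷ 6 ∷ 7 ∷ 8 ∷ 9 ∷ []))
    ∷ inj₂ (isoCertificate (2 ∷ 3 ∷ 4 ∷ 5 ∷ 0 ∷ 1 ∷ 6 ∷ 7 ∷ 8 ∷ 9 ∷ [])
                    (4 ∷ 5 ∷ 0 ∷ 1 ∷ 2 ∷ 3 ∷ 6 ∷ 7 ∷ 8 ∷ 9 ∷ []))
    ∷ inj₂ (isoCertificate (2 ∷ 3 ∷ 4 ∷ 0 ∷ 5 ∷ 1 ∷ 6 ∷ 7 ∷ 8 ∷ 9 ∷ [])
                    (3 ∷ 5 ∷ 0 ∷ 1 ∷ 2 ∷ 4 ∷ 6 ∷ 7 ∷ 8 ∷ 9 ∷ []))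
    ∷ inj₂ (isoCertificate (2 ∷ 3 ∷ 4 ∷ 0 ∷ 1 ∷ 5 ∷ 6 ∷ 7 ∷ 8 ∷ 9 ∷ [])
                    (3 ∷ 4 ∷ 0 ∷ 1 ∷ 2 ∷ 5 ∷ 6 ∷ 7 ∷ 8 ∷ 9 ∷ []))
    ∷ []

inflate-Fbar1 : ∀ u → NearPerfectMatchingCut (inflate Fbar1 Fbar1-cubic u) ⊎
                    Iso (inflate Fbar1 Fbar1-cubic u) Fbar2
inflate-Fbar1 u = Valid⇒ {H = Fbar2} (lookup certificates u)
  (from-yes (all? λ u → valid? (inflate Fbar1 Fbar1-cubic u) Fbar2 (lookup certificates u)) u)
  where
  certificates : Vec (Certificate 14) 10
  certificates = inj₂ (isoCertificate (4 ∷ 0 ∷ 1 ∷ 2 ∷ 3 ∷ 9 ∷ 10 ∷ 11 ∷ 12 ∷ 13 ∷ 5 ∷ 6 ∷ 7 ∷ 8 ∷ [])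
                    (1 ∷ 2 ∷ 3 ∷ 4 ∷ 0 ∷ 10 ∷ 11 ∷ 12 ∷ 13 ∷ 5 ∷ 6 ∷ 7 ∷ 8 ∷ 9 ∷ []))
    ∷ inj₂ (isoCertificate (0 ∷ 9 ∷ 1 ∷ 2 ∷ 3 ∷ 4 ∷ 5 ∷ 6 ∷ 7 ∷ 8 ∷ 10 ∷ 11 ∷ 12 ∷ 13 ∷ [])
                    (0 ∷ 2 ∷ 3 ∷ 4 ∷ 5 ∷ 6 ∷ 7 ∷ 8 ∷ 9 ∷ 1 ∷ 10 ∷ 11 ∷ 12 ∷ 13 ∷ []))
    ∷ inj₁ (cutCertificate (1 ∷ 1 ∷ 0 ∷ 1 ∷ 1 ∷ 0 ∷ 0 ∷ 0 ∷ 0 ∷ 0 ∷ 0 ∷ 0 ∷ 0 ∷ 0 ∷ [])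
                      (11 ∷ 12 ∷ 2 ∷ 8 ∷ 9 ∷ 5 ∷ 7 ∷ 6 ∷ 3 ∷ 4 ∷ 13 ∷ 0 ∷ 1 ∷ 10 ∷ []) 2 5)
    ∷ inj₁ (cutCertificate (1 ∷ 1 ∷ 1 ∷ 0 ∷ 1 ∷ 0 ∷ 0 ∷ 0 ∷ 0 ∷ 0 ∷ 0 ∷ 0 ∷ 0 ∷ 0 ∷ [])
                      (11 ∷ 12 ∷ 7 ∷ 3 ∷ 9 ∷ 5 ∷ 8 ∷ 2 ∷ 6 ∷ 4 ∷ 13 ∷ 0 ∷ 1 ∷ 10 ∷ []) 3 5)
    ∷ inj₁ (cutCertificate (1 ∷ 1 ∷ 1 ∷ 1 ∷ 0 ∷ 0 ∷ 0 ∷ 0 ∷ 0 ∷ 0 ∷ 0 ∷ 0 ∷ 0 ∷ 0 ∷ [])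
                      (11 ∷ 12 ∷ 7 ∷ 8 ∷ 4 ∷ 5 ∷ 9 ∷ 2 ∷ 3 ∷ 6 ∷ 13 ∷ 0 ∷ 1 ∷ 10 ∷ []) 4 5)
    ∷ inj₂ (isoCertificate (4 ∷ 5 ∷ 6 ∷ 7 ∷ 8 ∷ 9 ∷ 0 ∷ 1 ∷ 2 ∷ 3 ∷ 10 ∷ 11 ∷ 12 ∷ 13 ∷ [])
                    (6 ∷ 7 ∷ 8 ∷ 9 ∷ 0 ∷ 1 ∷ 2 ∷ 3 ∷ 4 ∷ 5 ∷ 10 ∷ 11 ∷ 12 ∷ 13 ∷ []))
    ∷ inj₂ (isoCertificate (4 ∷ 5 ∷ 6 ∷ 7 ∷ 8 ∷ 0 ∷ 9 ∷ 1 ∷ 2 ∷ 3 ∷ 10 ∷ 11 ∷ 12 ∷ 13 ∷ [])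
                    (5 ∷ 7 ∷ 8 ∷ 9 ∷ 0 ∷ 1 ∷ 2 ∷ 3 ∷ 4 ∷ 6 ∷ 10 ∷ 11 ∷ 12 ∷ 13 ∷ []))
    ∷ inj₁ (cutCertificate (1 ∷ 1 ∷ 1 ∷ 1 ∷ 1 ∷ 0 ∷ 0 ∷ 1 ∷ 0 ∷ 0 ∷ 1 ∷ 1 ∷ 1 ∷ 1 ∷ [])
                      (0 ∷ 2 ∷ 1 ∷ 8 ∷ 9 ∷ 12 ∷ 13 ∷ 7 ∷ 3 ∷ 4 ∷ 11 ∷ 10 ∷ 5 ∷ 6 ∷ []) 0 7)
    ∷ inj₁ (cutCertificate (1 ∷ 1 ∷ 1 ∷ 1 ∷ 1 ∷ 0 ∷ 0 ∷ 0 ∷ 1 ∷ 0 ∷ 1 ∷ 1 ∷ 1 ∷ 1 ∷ [])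
                      (0 ∷ 3 ∷ 7 ∷ 1 ∷ 9 ∷ 12 ∷ 13 ∷ 2 ∷ 8 ∷ 4 ∷ 11 ∷ 10 ∷ 5 ∷ 6 ∷ []) 0 8)
    ∷ inj₁ (cutCertificate (1 ∷ 1 ∷ 1 ∷ 1 ∷ 1 ∷ 0 ∷ 0 ∷ 0 ∷ 0 ∷ 1 ∷ 1 ∷ 1 ∷ 1 ∷ 1 ∷ [])
                      (0 ∷ 4 ∷ 7 ∷ 8 ∷ 1 ∷ 12 ∷ 13 ∷ 2 ∷ 3 ∷ 9 ∷ 11 ∷ 10 ∷ 5 ∷ 6 ∷ []) 0 9)
    ∷ []

inflate-Fbar2 : ∀ u → NearPerfectMatchingCut (inflate Fbar2 Fbar2-cubic u) ⊎
                    Iso (inflate Fbar2 Fbar2-cubic u) Fbar3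
inflate-Fbar2 u = Valid⇒ {H = Fbar3} (lookup certificates u)
  (from-yes (all? λ u → valid? (inflate Fbar2 Fbar2-cubic u) Fbar3 (lookup certificates u)) u)
  where
  certificates : Vec (Certificate 18) 14
  certificates = inj₂ (isoCertificate (0 ∷ 15 ∷ 16 ∷ 17 ∷ 5 ∷ 6 ∷ 7 ∷ 8 ∷ 9 ∷ 10 ∷ 11 ∷ 12 ∷ 13 ∷ 14 ∷ 1 ∷ 2 ∷ 3 ∷ 4 ∷ [])
                    (0 ∷ 14 ∷ 15 ∷ 16 ∷ 17 ∷ 4 ∷ 5 ∷ 6 ∷ 7 ∷ 8 ∷ 9 ∷ 10 ∷ 11 ∷ 12 ∷ 13 ∷ 1 ∷ 2 ∷ 3 ∷ []))
    ∷ inj₁ (cutCertificate (1 ∷ 0 ∷ 1 ∷ 1 ∷ 1 ∷ 1 ∷ 1 ∷ 1 ∷ 1 ∷ 0 ∷ 0 ∷ 0 ∷ 0 ∷ 0 ∷ 0 ∷ 0 ∷ 0 ∷ 0 ∷ [])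
                      (15 ∷ 1 ∷ 12 ∷ 13 ∷ 7 ∷ 8 ∷ 16 ∷ 4 ∷ 5 ∷ 9 ∷ 11 ∷ 10 ∷ 2 ∷ 3 ∷ 17 ∷ 0 ∷ 6 ∷ 14 ∷ []) 1 9)
    ∷ inj₁ (cutCertificate (1 ∷ 1 ∷ 0 ∷ 1 ∷ 1 ∷ 1 ∷ 1 ∷ 1 ∷ 1 ∷ 0 ∷ 0 ∷ 0 ∷ 0 ∷ 0 ∷ 0 ∷ 0 ∷ 0 ∷ 0 ∷ [])
                      (15 ∷ 11 ∷ 2 ∷ 13 ∷ 6 ∷ 8 ∷ 4 ∷ 16 ∷ 5 ∷ 9 ∷ 12 ∷ 1 ∷ 10 ∷ 3 ∷ 17 ∷ 0 ∷ 7 ∷ 14 ∷ []) 2 9)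
    ∷ inj₁ (cutCertificate (1 ∷ 1 ∷ 1 ∷ 0 ∷ 1 ∷ 1 ∷ 1 ∷ 1 ∷ 1 ∷ 0 ∷ 0 ∷ 0 ∷ 0 ∷ 0 ∷ 0 ∷ 0 ∷ 0 ∷ 0 ∷ [])
                      (15 ∷ 11 ∷ 12 ∷ 3 ∷ 6 ∷ 7 ∷ 4 ∷ 5 ∷ 16 ∷ 9 ∷ 13 ∷ 1 ∷ 2 ∷ 10 ∷ 17 ∷ 0 ∷ 8 ∷ 14 ∷ []) 3 9)
    ∷ inj₁ (cutCertificate (1 ∷ 1 ∷ 1 ∷ 0 ∷ 0 ∷ 1 ∷ 1 ∷ 1 ∷ 0 ∷ 0 ∷ 0 ∷ 0 ∷ 0 ∷ 0 ∷ 0 ∷ 0 ∷ 0 ∷ 0 ∷ [])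
                      (3 ∷ 11 ∷ 12 ∷ 0 ∷ 4 ∷ 8 ∷ 15 ∷ 16 ∷ 5 ∷ 9 ∷ 13 ∷ 1 ∷ 2 ∷ 10 ∷ 17 ∷ 6 ∷ 7 ∷ 14 ∷ []) 4 9)
    ∷ inj₁ (cutCertificate (1 ∷ 1 ∷ 1 ∷ 0 ∷ 1 ∷ 0 ∷ 1 ∷ 1 ∷ 0 ∷ 0 ∷ 0 ∷ 0 ∷ 0 ∷ 0 ∷ 0 ∷ 0 ∷ 0 ∷ 0 ∷ [])
                      (3 ∷ 11 ∷ 12 ∷ 0 ∷ 8 ∷ 5 ∷ 15 ∷ 16 ∷ 4 ∷ 9 ∷ 13 ∷ 1 ∷ 2 ∷ 10 ∷ 17 ∷ 6 ∷ 7 ∷ 14 ∷ []) 5 9)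
    ∷ inj₁ (cutCertificate (1 ∷ 1 ∷ 1 ∷ 1 ∷ 0 ∷ 0 ∷ 1 ∷ 0 ∷ 0 ∷ 1 ∷ 1 ∷ 1 ∷ 1 ∷ 1 ∷ 1 ∷ 1 ∷ 1 ∷ 1 ∷ [])
                      (0 ∷ 11 ∷ 7 ∷ 8 ∷ 16 ∷ 17 ∷ 6 ∷ 2 ∷ 3 ∷ 12 ∷ 13 ∷ 1 ∷ 9 ∷ 10 ∷ 15 ∷ 14 ∷ 4 ∷ 5 ∷ []) 0 6)
    ∷ inj₁ (cutCertificate (1 ∷ 1 ∷ 1 ∷ 1 ∷ 0 ∷ 0 ∷ 0 ∷ 1 ∷ 0 ∷ 1 ∷ 1 ∷ 1 ∷ 1 ∷ 1 ∷ 1 ∷ 1 ∷ 1 ∷ 1 ∷ [])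
                      (0 ∷ 6 ∷ 12 ∷ 8 ∷ 16 ∷ 17 ∷ 1 ∷ 7 ∷ 3 ∷ 11 ∷ 13 ∷ 9 ∷ 2 ∷ 10 ∷ 15 ∷ 14 ∷ 4 ∷ 5 ∷ []) 0 7)
    ∷ inj₁ (cutCertificate (1 ∷ 1 ∷ 1 ∷ 1 ∷ 0 ∷ 0 ∷ 0 ∷ 0 ∷ 1 ∷ 1 ∷ 1 ∷ 1 ∷ 1 ∷ 1 ∷ 1 ∷ 1 ∷ 1 ∷ 1 ∷ [])
                      (0 ∷ 6 ∷ 7 ∷ 13 ∷ 16 ∷ 17 ∷ 1 ∷ 2 ∷ 8 ∷ 11 ∷ 12 ∷ 9 ∷ 10 ∷ 3 ∷ 15 ∷ 14 ∷ 4 ∷ 5 ∷ []) 0 8)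
    ∷ inj₁ (cutCertificate (1 ∷ 1 ∷ 1 ∷ 0 ∷ 0 ∷ 0 ∷ 0 ∷ 0 ∷ 0 ∷ 0 ∷ 1 ∷ 1 ∷ 1 ∷ 0 ∷ 0 ∷ 0 ∷ 0 ∷ 0 ∷ [])
                      (3 ∷ 6 ∷ 7 ∷ 0 ∷ 4 ∷ 8 ∷ 1 ∷ 2 ∷ 5 ∷ 9 ∷ 13 ∷ 15 ∷ 16 ∷ 10 ∷ 17 ∷ 11 ∷ 12 ∷ 14 ∷ []) 4 9)
    ∷ inj₁ (cutCertificate (1 ∷ 1 ∷ 1 ∷ 0 ∷ 0 ∷ 0 ∷ 0 ∷ 0 ∷ 0 ∷ 1 ∷ 0 ∷ 1 ∷ 1 ∷ 0 ∷ 0 ∷ 0 ∷ 0 ∷ 0 ∷ [])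
                      (3 ∷ 6 ∷ 7 ∷ 0 ∷ 4 ∷ 8 ∷ 1 ∷ 2 ∷ 5 ∷ 13 ∷ 10 ∷ 15 ∷ 16 ∷ 9 ∷ 17 ∷ 11 ∷ 12 ∷ 14 ∷ []) 4 10)
    ∷ inj₁ (cutCertificate (1 ∷ 1 ∷ 1 ∷ 1 ∷ 1 ∷ 1 ∷ 1 ∷ 1 ∷ 1 ∷ 0 ∷ 0 ∷ 1 ∷ 0 ∷ 0 ∷ 1 ∷ 1 ∷ 1 ∷ 1 ∷ [])
                      (0 ∷ 6 ∷ 12 ∷ 13 ∷ 7 ∷ 8 ∷ 1 ∷ 4 ∷ 5 ∷ 16 ∷ 17 ∷ 11 ∷ 2 ∷ 3 ∷ 15 ∷ 14 ∷ 9 ∷ 10 ∷ []) 0 11)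
    ∷ inj₁ (cutCertificate (1 ∷ 1 ∷ 1 ∷ 1 ∷ 1 ∷ 1 ∷ 1 ∷ 1 ∷ 1 ∷ 0 ∷ 0 ∷ 0 ∷ 1 ∷ 0 ∷ 1 ∷ 1 ∷ 1 ∷ 1 ∷ [])
                      (0 ∷ 11 ∷ 7 ∷ 13 ∷ 6 ∷ 8 ∷ 4 ∷ 2 ∷ 5 ∷ 16 ∷ 17 ∷ 1 ∷ 12 ∷ 3 ∷ 15 ∷ 14 ∷ 9 ∷ 10 ∷ []) 0 12)
    ∷ inj₁ (cutCertificate (1 ∷ 1 ∷ 1 ∷ 1 ∷ 1 ∷ 1 ∷ 1 ∷ 1 ∷ 1 ∷ 0 ∷ 0 ∷ 0 ∷ 0 ∷ 1 ∷ 1 ∷ 1 ∷ 1 ∷ 1 ∷ [])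
                      (0 ∷ 11 ∷ 12 ∷ 8 ∷ 6 ∷ 7 ∷ 4 ∷ 5 ∷ 3 ∷ 16 ∷ 17 ∷ 1 ∷ 2 ∷ 13 ∷ 15 ∷ 14 ∷ 9 ∷ 10 ∷ []) 0 13)
    ∷ []

inflate-Fbar3 : ∀ u → NearPerfectMatchingCut (inflate Fbar3 Fbar3-cubic u)
inflate-Fbar3 u = ValidCut⇒cut (lookup certificates u)
  (from-yes (all? λ u → validCut? (inflate Fbar3 Fbar3-cubic u) (lookup certificates u)) u)
  where
  certificates : Vec (CutCertificate 22) 18
  certificates = (cutCertificate (1 ∷ 0 ∷ 1 ∷ 0 ∷ 0 ∷ 1 ∷ 1 ∷ 1 ∷ 1 ∷ 1 ∷ 0 ∷ 0 ∷ 0 ∷ 0 ∷ 0 ∷ 1 ∷ 0 ∷ 0 ∷ 1 ∷ 1 ∷ 1 ∷ 1 ∷ [])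
                      (0 ∷ 2 ∷ 1 ∷ 20 ∷ 21 ∷ 5 ∷ 7 ∷ 6 ∷ 16 ∷ 17 ∷ 13 ∷ 14 ∷ 15 ∷ 10 ∷ 11 ∷ 12 ∷ 8 ∷ 9 ∷ 19 ∷ 18 ∷ 3 ∷ 4 ∷ []) 0 5)
    ∷ (cutCertificate (1 ∷ 0 ∷ 1 ∷ 1 ∷ 0 ∷ 1 ∷ 1 ∷ 1 ∷ 1 ∷ 1 ∷ 0 ∷ 0 ∷ 0 ∷ 0 ∷ 0 ∷ 1 ∷ 1 ∷ 0 ∷ 0 ∷ 0 ∷ 0 ∷ 0 ∷ [])
                      (4 ∷ 1 ∷ 19 ∷ 20 ∷ 0 ∷ 7 ∷ 8 ∷ 5 ∷ 6 ∷ 17 ∷ 10 ∷ 14 ∷ 15 ∷ 16 ∷ 11 ∷ 12 ∷ 13 ∷ 9 ∷ 21 ∷ 2 ∷ 3 ∷ 18 ∷ []) 1 10)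
    ∷ (cutCertificate (1 ∷ 1 ∷ 0 ∷ 1 ∷ 1 ∷ 0 ∷ 0 ∷ 0 ∷ 0 ∷ 0 ∷ 0 ∷ 0 ∷ 0 ∷ 0 ∷ 0 ∷ 0 ∷ 0 ∷ 0 ∷ 0 ∷ 0 ∷ 0 ∷ 0 ∷ [])
                      (19 ∷ 20 ∷ 2 ∷ 16 ∷ 17 ∷ 8 ∷ 9 ∷ 7 ∷ 5 ∷ 6 ∷ 13 ∷ 14 ∷ 15 ∷ 10 ∷ 11 ∷ 12 ∷ 3 ∷ 4 ∷ 21 ∷ 0 ∷ 1 ∷ 18 ∷ []) 2 7)
    ∷ (cutCertificate (1 ∷ 1 ∷ 1 ∷ 0 ∷ 1 ∷ 0 ∷ 0 ∷ 0 ∷ 0 ∷ 0 ∷ 0 ∷ 0 ∷ 0 ∷ 0 ∷ 0 ∷ 0 ∷ 0 ∷ 0 ∷ 0 ∷ 0 ∷ 0 ∷ 0 ∷ [])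
                      (19 ∷ 20 ∷ 15 ∷ 3 ∷ 17 ∷ 8 ∷ 9 ∷ 7 ∷ 5 ∷ 6 ∷ 12 ∷ 14 ∷ 10 ∷ 16 ∷ 11 ∷ 2 ∷ 13 ∷ 4 ∷ 21 ∷ 0 ∷ 1 ∷ 18 ∷ []) 3 7)
    ∷ (cutCertificate (1 ∷ 1 ∷ 1 ∷ 1 ∷ 0 ∷ 0 ∷ 0 ∷ 0 ∷ 0 ∷ 0 ∷ 0 ∷ 0 ∷ 0 ∷ 0 ∷ 0 ∷ 0 ∷ 0 ∷ 0 ∷ 0 ∷ 0 ∷ 0 ∷ 0 ∷ [])
                      (19 ∷ 20 ∷ 15 ∷ 16 ∷ 4 ∷ 8 ∷ 9 ∷ 7 ∷ 5 ∷ 6 ∷ 12 ∷ 13 ∷ 10 ∷ 11 ∷ 17 ∷ 2 ∷ 3 ∷ 14 ∷ 21 ∷ 0 ∷ 1 ∷ 18 ∷ []) 4 7)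
    ∷ (cutCertificate (1 ∷ 1 ∷ 1 ∷ 1 ∷ 1 ∷ 0 ∷ 1 ∷ 1 ∷ 1 ∷ 0 ∷ 0 ∷ 0 ∷ 0 ∷ 0 ∷ 0 ∷ 1 ∷ 1 ∷ 0 ∷ 0 ∷ 0 ∷ 0 ∷ 0 ∷ [])
                      (2 ∷ 3 ∷ 0 ∷ 1 ∷ 17 ∷ 5 ∷ 9 ∷ 19 ∷ 20 ∷ 6 ∷ 10 ∷ 14 ∷ 15 ∷ 16 ∷ 11 ∷ 12 ∷ 13 ∷ 4 ∷ 21 ∷ 7 ∷ 8 ∷ 18 ∷ []) 5 10)
    ∷ (cutCertificate (1 ∷ 1 ∷ 1 ∷ 1 ∷ 1 ∷ 1 ∷ 0 ∷ 1 ∷ 1 ∷ 0 ∷ 0 ∷ 0 ∷ 0 ∷ 0 ∷ 0 ∷ 1 ∷ 1 ∷ 0 ∷ 0 ∷ 0 ∷ 0 ∷ 0 ∷ [])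
                      (2 ∷ 3 ∷ 0 ∷ 1 ∷ 17 ∷ 9 ∷ 6 ∷ 19 ∷ 20 ∷ 5 ∷ 10 ∷ 14 ∷ 15 ∷ 16 ∷ 11 ∷ 12 ∷ 13 ∷ 4 ∷ 21 ∷ 7 ∷ 8 ∷ 18 ∷ []) 6 10)
    ∷ (cutCertificate (1 ∷ 1 ∷ 1 ∷ 1 ∷ 1 ∷ 0 ∷ 0 ∷ 1 ∷ 0 ∷ 0 ∷ 1 ∷ 1 ∷ 1 ∷ 1 ∷ 1 ∷ 1 ∷ 1 ∷ 1 ∷ 1 ∷ 1 ∷ 1 ∷ 1 ∷ [])
                      (3 ∷ 4 ∷ 2 ∷ 0 ∷ 1 ∷ 19 ∷ 20 ∷ 7 ∷ 16 ∷ 17 ∷ 13 ∷ 14 ∷ 15 ∷ 10 ∷ 11 ∷ 12 ∷ 8 ∷ 9 ∷ 21 ∷ 5 ∷ 6 ∷ 18 ∷ []) 2 7)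
    ∷ (cutCertificate (1 ∷ 1 ∷ 1 ∷ 1 ∷ 1 ∷ 0 ∷ 0 ∷ 0 ∷ 1 ∷ 0 ∷ 1 ∷ 1 ∷ 1 ∷ 1 ∷ 1 ∷ 1 ∷ 1 ∷ 1 ∷ 1 ∷ 1 ∷ 1 ∷ 1 ∷ [])
                      (3 ∷ 4 ∷ 2 ∷ 0 ∷ 1 ∷ 19 ∷ 20 ∷ 15 ∷ 8 ∷ 17 ∷ 12 ∷ 14 ∷ 10 ∷ 16 ∷ 11 ∷ 7 ∷ 13 ∷ 9 ∷ 21 ∷ 5 ∷ 6 ∷ 18 ∷ []) 2 8)
    ∷ (cutCertificate (1 ∷ 1 ∷ 1 ∷ 1 ∷ 1 ∷ 0 ∷ 0 ∷ 0 ∷ 0 ∷ 1 ∷ 1 ∷ 1 ∷ 1 ∷ 1 ∷ 1 ∷ 1 ∷ 1 ∷ 1 ∷ 1 ∷ 1 ∷ 1 ∷ 1 ∷ [])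
                      (3 ∷ 4 ∷ 2 ∷ 0 ∷ 1 ∷ 19 ∷ 20 ∷ 15 ∷ 16 ∷ 9 ∷ 12 ∷ 13 ∷ 10 ∷ 11 ∷ 17 ∷ 7 ∷ 8 ∷ 14 ∷ 21 ∷ 5 ∷ 6 ∷ 18 ∷ []) 2 9)
    ∷ (cutCertificate (1 ∷ 1 ∷ 1 ∷ 1 ∷ 1 ∷ 0 ∷ 0 ∷ 0 ∷ 0 ∷ 0 ∷ 0 ∷ 1 ∷ 1 ∷ 1 ∷ 0 ∷ 1 ∷ 1 ∷ 0 ∷ 0 ∷ 0 ∷ 0 ∷ 0 ∷ [])
                      (2 ∷ 3 ∷ 0 ∷ 1 ∷ 17 ∷ 5 ∷ 9 ∷ 15 ∷ 16 ∷ 6 ∷ 10 ∷ 14 ∷ 19 ∷ 20 ∷ 11 ∷ 7 ∷ 8 ∷ 4 ∷ 21 ∷ 12 ∷ 13 ∷ 18 ∷ []) 5 10)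
    ∷ (cutCertificate (1 ∷ 1 ∷ 1 ∷ 1 ∷ 1 ∷ 0 ∷ 0 ∷ 0 ∷ 0 ∷ 0 ∷ 1 ∷ 0 ∷ 1 ∷ 1 ∷ 0 ∷ 1 ∷ 1 ∷ 0 ∷ 0 ∷ 0 ∷ 0 ∷ 0 ∷ [])
                      (2 ∷ 3 ∷ 0 ∷ 1 ∷ 17 ∷ 5 ∷ 9 ∷ 15 ∷ 16 ∷ 6 ∷ 14 ∷ 11 ∷ 19 ∷ 20 ∷ 10 ∷ 7 ∷ 8 ∷ 4 ∷ 21 ∷ 12 ∷ 13 ∷ 18 ∷ []) 5 11)
    ∷ (cutCertificate (1 ∷ 1 ∷ 1 ∷ 1 ∷ 1 ∷ 1 ∷ 1 ∷ 1 ∷ 1 ∷ 1 ∷ 0 ∷ 0 ∷ 1 ∷ 0 ∷ 0 ∷ 1 ∷ 1 ∷ 1 ∷ 1 ∷ 1 ∷ 1 ∷ 1 ∷ [])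
                      (3 ∷ 4 ∷ 2 ∷ 0 ∷ 1 ∷ 8 ∷ 9 ∷ 15 ∷ 5 ∷ 6 ∷ 19 ∷ 20 ∷ 12 ∷ 16 ∷ 17 ∷ 7 ∷ 13 ∷ 14 ∷ 21 ∷ 10 ∷ 11 ∷ 18 ∷ []) 2 12)
    ∷ (cutCertificate (1 ∷ 1 ∷ 1 ∷ 1 ∷ 1 ∷ 1 ∷ 1 ∷ 1 ∷ 1 ∷ 1 ∷ 0 ∷ 0 ∷ 0 ∷ 1 ∷ 0 ∷ 1 ∷ 1 ∷ 1 ∷ 1 ∷ 1 ∷ 1 ∷ 1 ∷ [])
                      (3 ∷ 4 ∷ 2 ∷ 0 ∷ 1 ∷ 7 ∷ 9 ∷ 5 ∷ 16 ∷ 6 ∷ 19 ∷ 20 ∷ 15 ∷ 13 ∷ 17 ∷ 12 ∷ 8 ∷ 14 ∷ 21 ∷ 10 ∷ 11 ∷ 18 ∷ []) 2 13)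
    ∷ (cutCertificate (1 ∷ 1 ∷ 1 ∷ 1 ∷ 1 ∷ 1 ∷ 1 ∷ 1 ∷ 1 ∷ 1 ∷ 0 ∷ 0 ∷ 0 ∷ 0 ∷ 1 ∷ 1 ∷ 1 ∷ 1 ∷ 1 ∷ 1 ∷ 1 ∷ 1 ∷ [])
                      (3 ∷ 4 ∷ 2 ∷ 0 ∷ 1 ∷ 7 ∷ 8 ∷ 5 ∷ 6 ∷ 17 ∷ 19 ∷ 20 ∷ 15 ∷ 16 ∷ 14 ∷ 12 ∷ 13 ∷ 9 ∷ 21 ∷ 10 ∷ 11 ∷ 18 ∷ []) 2 14)
    ∷ (cutCertificate (1 ∷ 1 ∷ 1 ∷ 1 ∷ 1 ∷ 1 ∷ 1 ∷ 1 ∷ 1 ∷ 1 ∷ 0 ∷ 0 ∷ 0 ∷ 0 ∷ 0 ∷ 0 ∷ 1 ∷ 1 ∷ 0 ∷ 0 ∷ 0 ∷ 0 ∷ [])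
                      (3 ∷ 4 ∷ 19 ∷ 0 ∷ 1 ∷ 8 ∷ 9 ∷ 20 ∷ 5 ∷ 6 ∷ 10 ∷ 12 ∷ 11 ∷ 16 ∷ 17 ∷ 15 ∷ 13 ∷ 14 ∷ 21 ∷ 2 ∷ 7 ∷ 18 ∷ []) 10 15)
    ∷ (cutCertificate (1 ∷ 1 ∷ 1 ∷ 1 ∷ 1 ∷ 1 ∷ 1 ∷ 1 ∷ 1 ∷ 1 ∷ 0 ∷ 0 ∷ 0 ∷ 0 ∷ 0 ∷ 1 ∷ 0 ∷ 1 ∷ 0 ∷ 0 ∷ 0 ∷ 0 ∷ [])
                      (2 ∷ 4 ∷ 0 ∷ 19 ∷ 1 ∷ 7 ∷ 9 ∷ 5 ∷ 20 ∷ 6 ∷ 10 ∷ 13 ∷ 15 ∷ 11 ∷ 17 ∷ 12 ∷ 16 ∷ 14 ∷ 21 ∷ 3 ∷ 8 ∷ 18 ∷ []) 10 16)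
    ∷ (cutCertificate (1 ∷ 1 ∷ 1 ∷ 1 ∷ 1 ∷ 1 ∷ 1 ∷ 1 ∷ 1 ∷ 1 ∷ 0 ∷ 0 ∷ 0 ∷ 0 ∷ 0 ∷ 1 ∷ 1 ∷ 0 ∷ 0 ∷ 0 ∷ 0 ∷ 0 ∷ [])
                      (2 ∷ 3 ∷ 0 ∷ 1 ∷ 19 ∷ 7 ∷ 8 ∷ 5 ∷ 6 ∷ 20 ∷ 10 ∷ 14 ∷ 15 ∷ 16 ∷ 11 ∷ 12 ∷ 13 ∷ 17 ∷ 21 ∷ 4 ∷ 9 ∷ 18 ∷ []) 10 17)
    ∷ []

-- The class 𝓕

data Exceptional {n} (G : Graph n) : Set where
  ≅Fbar0 : Iso G Fbar0 → Exceptional G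
  ≅Fbar1 : Iso G Fbar1 → Exceptional G
  ≅Fbar2 : Iso G Fbar2 → Exceptional G
  ≅Fbar3 : Iso G Fbar3 → Exceptional G

Exceptional-matchingCovered : ∀ {n} {G : Graph n} → Exceptional G → MatchingCovered G
Exceptional-matchingCovered (≅Fbar0 I) = MatchingCovered-transport I K33-matchingCovered
Exceptional-matchingCovered (≅Fbar1 I) = MatchingCovered-transport I Fbar1-matchingCovered
Exceptional-matchingCovered (≅Fbar2 I) = MatchingCovered-transport I Fbar2-matchingCovered
Exceptional-matchingCovered (≅Fbar3 I) = MatchingCovered-transport I Fbar3-matchingCovered

Block-matchingCovered : ∀ {m} {H : Graph m} → Block H → MatchingCovered H
Block-matchingCovered heawood = Heawood-matchingCovered
Block-matchingCovered k33     = K33-matchingCovered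

cutOrIso-transport : ∀ {n m k} {G : Graph n} {P : Graph m} {K : Graph k} → Iso G P →
                     NearPerfectMatchingCut P ⊎ Iso P K → NearPerfectMatchingCut G ⊎ Iso G K
cutOrIso-transport {G = G} {P} {K} I =
  Sum.map (NearPerfectMatchingCut-transport I) (Iso-trans {G = G} {P} {K} I)

module _ {n₁ n} {G₁ : Graph n₁} {u : Fin n₁} {v : Fin 6} {G : Graph n} (S : IsStarProduct G₁ u K33 v G) where

  inflation-iso : ∀ {m} {F : Graph m} (I : Iso G₁ F) (F-cubic : Cubic F) →
                  Iso G (inflate F F-cubic (Inverse.to (proj₁ I) u))
  inflation-iso I F-cubic = StarProductK33.iso F-cubic (IsStarProduct-transportˡ I S)

  Exceptional-starK33 : Exceptional G₁ → NearPerfectMatchingCut G ⊎ Exceptional G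
  Exceptional-starK33 (≅Fbar0 I) =
    Sum.map₂ ≅Fbar1 (cutOrIso-transport {K = Fbar1} (inflation-iso I K33-cubic) (inflate-Fbar0 _))
  Exceptional-starK33 (≅Fbar1 I) =
    Sum.map₂ ≅Fbar2 (cutOrIso-transport {K = Fbar2} (inflation-iso I Fbar1-cubic) (inflate-Fbar1 _))
  Exceptional-starK33 (≅Fbar2 I) =
    Sum.map₂ ≅Fbar3 (cutOrIso-transport {K = Fbar3} (inflation-iso I Fbar2-cubic) (inflate-Fbar2 _))
  Exceptional-starK33 (≅Fbar3 I) =
    inj₁ (NearPerfectMatchingCut-transport (inflation-iso I Fbar3-cubic) (inflate-Fbar3 _))

classification : ∀ {n} {G : Graph n} → InF G → NearPerfectMatchingCut G ⊎ Exceptional G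
classification (base heawood I) = inj₁ (NearPerfectMatchingCut-transport I Heawood-cut)
classification (base k33 I)     = inj₂ (≅Fbar0 I)
classification (step G₁∈F B u v S) with classification G₁∈F | B
... | inj₁ C | _       = inj₁ (NearPerfectMatchingCut-starProduct C (Block-matchingCovered B) S)
... | inj₂ E | heawood =
  inj₁ (NearPerfectMatchingCut-starProduct Heawood-cut (Exceptional-matchingCovered E) (IsStarProduct-swap S))
... | inj₂ E | k33     = Exceptional-starK33 S E

theorem5 : ∀ {n} (G : Graph n) → InF G →
    ¬ Iso G Fbar0 → ¬ Iso G Fbar1 → ¬ Iso G Fbar2 → ¬ Iso G Fbar3 →
    MmsAtLeastHalfMinusOne G
theorem5 G G∈F ≇Fbar0 ≇Fbar1 ≇Fbar2 ≇Fbar3 with classification G∈F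
... | inj₁ C          = nearPerfectMatchingCut⇒mms C
... | inj₂ (≅Fbar0 I) = ⊥-elim (≇Fbar0 I)
... | inj₂ (≅Fbar1 I) = ⊥-elim (≇Fbar1 I)
... | inj₂ (≅Fbar2 I) = ⊥-elim (≇Fbar2 I)
... | inj₂ (≅Fbar3 I) = ⊥-elim (≇Fbar3 I)
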